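{- Let $\phi_1,\dots,\phi_n$ be group homomorphisms $\phi_i:\mathbb{Z}^d\to\mathbb{Z}^{d_i}$. Suppose there exists an optimal solution $y$ of the dual LP whose support consists of independent subgroups $Y_1,\dots,Y_t$ of $\mathbb{Z}^d$. Then there is a family of parallelepipeds $S(M)$ (namely the product parallelepipeds built from $Y_1,\dots,Y_t$ with values $y_{Y_1},\dots,y_{Y_t}$) forming asymptotically optimal tilings of $\mathbb{Z}^d$.
   Context: For a subgroup $H\le\mathbb{Z}^d$, $\mathrm{rank}(H)$ is its rank. The HBL primal LP: minimize $\sum_is_i$ over $s\ge0$ subject to $\sum_is_i\,\mathrm{rank}(\phi_i(H))\ge\mathrm{rank}(H)$ for all subgroups $H\le\mathbb{Z}^d$; its optimal value is $s_{\mathrm{HBL}}$. A dual vector $y$ is indexed by all subgroups of $\mathbb{Z}^d$ with finitely many nonzero coordinates (its support); $\mathrm{val}(y)=\sum_Ey_E\,\mathrm{rank}(E)$; $y$ is dual feasible if $y_E\ge0$ and $\sum_Ey_E\,\mathrm{rank}(\phi_i(E))\le1$ for all $i$; the dual LP maximizes $\mathrm{val}(y)$ over dual feasible $y$ (its optimal value is $s_{\mathrm{HBL}}$). Subgroups are independent if the rank of their sum is the sum of their ranks. Product parallelepiped: for integer $M\ge1$, for each $i$ choose $\mathrm{rank}(Y_i)$ linearly independent elements $e_{ij}$ of $Y_i$, let $S_{Y_i}=\{\sum_ja_je_{ij}:a_j\in\mathbb{Z},0\le a_j\le\lfloor M^{y_{Y_i}}\rfloor-1\}$ and $S=S_{Y_1}+\dots+S_{Y_t}$.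 A family $S(M)$ forms asymptotically optimal tilings if translates of $S(M)$ tile $\mathbb{Z}^d$ (disjointly cover it), $|S(M)|=\Theta(M^{s_{\mathrm{HBL}}})$, and $|\phi_i(S(M))|=O(M)$ for all $i$, as $M\to\infty$.
   Formalization: The optimal dual solution y has rational values $y_{Y_1},\dots,y_{Y_t}$, and its optimality is tested against rational dual feasible vectors. -}

module Defs where

open import Level using (Level; 0ℓ)
open import Data.Nat as ℕ using (ℕ; zero; suc; _^_)
import Data.Nat.Properties as ℕP
open import Data.Integer as ℤ using (ℤ; +_)
import Data.Integer.Properties as ℤP
import Data.Rational.Properties as ℚP
open import Data.Rational as ℚ using (ℚ; ↥_; ↧ₙ_; 0ℚ; 1ℚ)
open import Data.Fin using (Fin; zero; suc)
open import Data.Vec as Vec using (Vec; []; _∷_)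
import Data.Vec.Properties as VecP
open import Data.List as List using (List; []; _∷_)
open import Data.Product using (Σ; ∃; _×_; _,_)
open import Relation.Nullary using (¬_; Dec)
open import Relation.Binary.PropositionalEquality using (_≡_)
open import Data.List.Membership.Propositional renaming (_∈_ to _∈L_)

V : ℕ → Set
V d = Vec ℤ d

0v : ∀ {d} → V d
0v {d} = Vec.replicate d (+ 0)

_+v_ : ∀ {d} → V d → V d → V d
_+v_ = Vec.zipWith ℤ._+_

-v_ : ∀ {d} → V d → V d
-v_ = Vec.map (λ x → ℤ.- x)

_·v_ : ∀ {d} → ℤ → V d → V d
a ·v v = Vec.map (a ℤ.*_) v

_≟v_ : ∀ {d} (u v : V d) → Dec (u ≡ v)
_≟v_ = VecP.≡-dec ℤ._≟_

lincomb : ∀ {d r} → (Fin r → ℤ) → (Fin r → V d) → V d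
lincomb {r = zero}  a e = 0v
lincomb {r = suc r} a e = (a zero ·v e zero) +v lincomb (λ j → a (suc j)) (λ j → e (suc j))

sumV : ∀ {d t} → (Fin t → V d) → V d
sumV {t = zero}  v = 0v
sumV {t = suc t} v = v zero +v sumV (λ i → v (suc i))

-- e_1,…,e_r are linearly independent (over ℤ, equivalently over ℚ)
LinIndep : ∀ {d r} → (Fin r → V d) → Set
LinIndep {r = r} e = (a : Fin r → ℤ) → lincomb a e ≡ 0v → (j : Fin r) → a j ≡ + 0

record Subgroup (d : ℕ) : Set₁ where
  field
    _∋_   : V d → Set
    ∋-0   : _∋_ 0v
    ∋-+   : ∀ {u v} → _∋_ u → _∋_ v → _∋_ (u +v v)
    ∋-neg : ∀ {u} → _∋_ u → _∋_ (-v u)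
open Subgroup public

HasRank : ∀ {d} → (V d → Set) → ℕ → Set
HasRank {d} P r =
  (Σ (Fin r → V d) λ e → ((j : Fin r) → P (e j)) × LinIndep e)
  × ((e : Fin (suc r) → V d) → ((j : Fin (suc r)) → P (e j)) → ¬ LinIndep e)

Img : ∀ {d m} → (V d → V m) → Subgroup d → V m → Set
Img {d} φ H w = Σ (V d) λ v → (H ∋ v) × (φ v ≡ w)

SumOf : ∀ {d t} → (Fin t → Subgroup d) → V d → Set
SumOf {d} {t} Y x = Σ (Fin t → V d) λ v → ((i : Fin t) → Y i ∋ v i) × (sumV v ≡ x)

IsHom : ∀ {d m} → (V d → V m) → Set
IsHom φ = ∀ u v → φ (u +v v) ≡ φ u +v φ v

-- Dual LP (finitely supported dual vectors as lists of entries; each entry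
-- records the subgroup E, its coefficient y_E ≥ 0, and the ranks of E and
-- of φ_i(E), certified by HasRank)

module DualLP {d n : ℕ} (ds : Fin n → ℕ) (φ : (i : Fin n) → V d → V (ds i)) where

  record Entry : Set₁ where
    field
      E     : Subgroup d
      coef  : ℚ
      coef≥0 : 0ℚ ℚ.≤ coef
      rk    : ℕ
      rkOK  : HasRank (E ∋_) rk
      rkφ   : Fin n → ℕ
      rkφOK : (i : Fin n) → HasRank (Img (φ i) E) (rkφ i)

  sumℚ : List ℚ → ℚ
  sumℚ = List.foldr ℚ._+_ 0ℚ

  ℕ→ℚ : ℕ → ℚ
  ℕ→ℚ k = (+ k) ℚ./ 1

  val : List Entry → ℚ
  val y = sumℚ (List.map (λ x → Entry.coef x ℚ.* ℕ→ℚ (Entry.rk x)) y)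

  Feasible : List Entry → Set
  Feasible y = (i : Fin n) →
    sumℚ (List.map (λ x → Entry.coef x ℚ.* ℕ→ℚ (Entry.rkφ x i)) y) ℚ.≤ 1ℚ

  Optimal : List Entry → Set₁
  Optimal y = Feasible y × ((y' : List Entry) → Feasible y' → val y' ℚ.≤ val y)

-- ⌊ M ^ q ⌋ for rational q ≥ 0 :  with q = p / s (lowest terms),
-- ⌊ M^(p/s) ⌋ = #{ k ∈ {1,…,M^p} : k^s ≤ M^p }   (for M ≥ 1)

numℕ : ℚ → ℕ
numℕ q = ℤ.∣ ↥ q ∣

floorPow : ℕ → ℚ → ℕ
floorPow M q =
  List.length (List.filter (λ k → k ^ (↧ₙ q) ℕ.≤? M ^ numℕ q)
                           (List.map suc (List.upTo (M ^ numℕ q))))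

boxes : (r K : ℕ) → List (Fin r → ℕ)
boxes zero    K = (λ ()) ∷ []
boxes (suc r) K =
  List.concatMap (λ a → List.map (λ rest → λ { zero → a ; (suc j) → rest j }) (boxes r K))
                 (List.upTo K)

_⊕_ : ∀ {d} → List (V d) → List (V d) → List (V d)
xs ⊕ ys = List.concatMap (λ u → List.map (u +v_) ys) xs

⊕-all : ∀ {d t} → (Fin t → List (V d)) → List (V d)
⊕-all {t = zero}  S = 0v ∷ []
⊕-all {t = suc t} S = S zero ⊕ ⊕-all (λ i → S (suc i))

S-Y : ∀ {d r} → (Fin r → V d) → ℕ → List (V d)
S-Y {r = r} e K = List.map (λ a → lincomb (λ j → + a j) e) (boxes r K)

productParallelepiped : ∀ {d t} (r : Fin t → ℕ) (e : (i : Fin t) → Fin (r i) → V d)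
  (yv : Fin t → ℚ) (M : ℕ) → List (V d)
productParallelepiped r e yv M = ⊕-all (λ i → S-Y (e i) (floorPow M (yv i)))

card : ∀ {m} → List (V m) → ℕ
card xs = List.length (List.deduplicate _≟v_ xs)

Tiles : ∀ {d} → List (V d) → Set₁
Tiles {d} S = Σ (V d → Set) λ T →
    ((x : V d) → Σ (V d) λ t → Σ (V d) λ s → T t × (s ∈L S) × (t +v s ≡ x))
  × (∀ {t t' s s'} → T t → T t' → s ∈L S → s' ∈L S → t +v s ≡ t' +v s' → t ≡ t')

-- f(M) = Θ(M^q) as M → ∞  (q = p/s ≥ 0 rational):
-- ∃ C₁ C₂ M₀, ∀ M ≥ M₀, M^p ≤ C₁ f(M)^s and f(M)^s ≤ C₂ M^p
-- (i.e. c M^q ≤ f(M) ≤ C M^q with c = C₁^(-1/s) > 0, C = C₂^(1/s))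
IsΘPow : (ℕ → ℕ) → ℚ → Set
IsΘPow f q = Σ ℕ λ C₁ → Σ ℕ λ C₂ → Σ ℕ λ M₀ → ∀ M → M₀ ℕ.≤ M →
  (M ^ numℕ q ℕ.≤ C₁ ℕ.* (f M ^ ↧ₙ q)) × (f M ^ ↧ₙ q ℕ.≤ C₂ ℕ.* M ^ numℕ q)

IsBigOM : (ℕ → ℕ) → Set
IsBigOM f = Σ ℕ λ C → Σ ℕ λ M₀ → ∀ M → M₀ ℕ.≤ M → f M ℕ.≤ C ℕ.* M

AsymptoticallyOptimalTilings : {d n : ℕ} (ds : Fin n → ℕ) (φ : (i : Fin n) → V d → V (ds i))
  (sHBL : ℚ) (S : ℕ → List (V d)) → Set₁
AsymptoticallyOptimalTilings {n = n} ds φ sHBL S =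
    ((M : ℕ) → 1 ℕ.≤ M → Tiles (S M))
  × IsΘPow (λ M → card (S M)) sHBL
  × ((i : Fin n) → IsBigOM (λ M → card (List.map (φ i) (S M))))

module _ {d n : ℕ} (ds : Fin n → ℕ) (φ : (i : Fin n) → V d → V (ds i)) where
  open DualLP ds φ

  dualVector : {t : ℕ} (Y : Fin t → Subgroup d) (yv : Fin t → ℚ)
    (yv>0 : (i : Fin t) → 0ℚ ℚ.< yv i)
    (r : Fin t → ℕ) (rOK : (i : Fin t) → HasRank (Y i ∋_) (r i))
    (rφ : Fin t → Fin n → ℕ) (rφOK : (i : Fin t) (k : Fin n) → HasRank (Img (φ k) (Y i)) (rφ i k))
    → List Entry
  dualVector Y yv yv>0 r rOK rφ rφOK = List.tabulate λ i → record
    { E = Y i ; coef = yv i ; coef≥0 = ℚP.<⇒≤ (yv>0 i)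
    ; rk = r i ; rkOK = rOK i ; rkφ = rφ i ; rkφOK = rφOK i }

sumℕ : ∀ {t} → (Fin t → ℕ) → ℕ
sumℕ {zero}  f = 0
sumℕ {suc t} f = f zero ℕ.+ sumℕ (λ i → f (suc i))

-- Let E be the bases of the Yᵢ taken together. Since rank (Y₁ + ⋯ + Y_t) = Σ rank Yᵢ, E is linearly
-- independent: otherwise one vector of E could be dropped and the remaining Σ rank Yᵢ − 1 vectors would
-- span Σ rank Yᵢ independent ones over ℚ, contradicting the Steinitz exchange lemma. An independent E
-- has an integral dual basis Λ with Λₗ · Eₘ = D δₗₘ, and the digits ⌊Λₗ · x / D⌋ mod Kᵢ, where
-- Kᵢ = ⌊M ^ yᵢ⌋, locate x in a translate of the parallelepiped S. Hence translates of S tile ℤ^d and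
-- |S| = Πᵢ Kᵢ ^ rank Yᵢ ≈ M ^ Σᵢ yᵢ rank Yᵢ = M ^ val(y). For the images, φ(S_{Yᵢ}) lies in the
-- group φ(Yᵢ) of rank ρᵢ, with dual coordinates of size O(Kᵢ), so
-- |φ(S)| ≤ Πᵢ |φ(S_{Yᵢ})| = O(Πᵢ Kᵢ ^ ρᵢ) = O(M ^ Σᵢ yᵢ ρᵢ) = O(M) by feasibility of y.

module Submission where

open import Defs

open import Data.Empty using (⊥; ⊥-elim)
open import Data.Fin using (Fin; zero; suc; punchIn; punchOut; splitAt; _↑ˡ_; _↑ʳ_; join)
import Data.Fin.Properties as FinP
open import Data.Integer as ℤ using (ℤ; +_; -[1+_]; +[1+_])
open import Data.Integer.DivMod using (_/ℕ_; _%ℕ_; n%ℕd<d; a≡a%ℕn+[a/ℕn]*n)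
import Data.Integer.Properties as ℤP
import Data.Integer.GCD
import Data.Integer.Tactic.RingSolver as ℤSolver
open import Data.Nat as ℕ using (ℕ; zero; suc; NonZero; z≤n; s≤s; _^_)
import Data.Nat.Properties as ℕP
import Data.Nat.Tactic.RingSolver as ℕSolver
open import Data.Rational as ℚ using (ℚ; mkℚ; ↥_; ↧_; ↧ₙ_; 0ℚ; 1ℚ; toℚᵘ)
import Data.Rational.Properties as ℚP
open import Data.Rational.Unnormalised as ℚᵘ using (ℚᵘ; mkℚᵘ; _≃_; *≡*)
import Data.Rational.Unnormalised.Properties as ℚᵘP
open import Data.Product using (Σ; ∃; _×_; _,_; proj₁; proj₂)
open import Data.Sum using (inj₁; inj₂)
open import Data.List as List using (List; []; _∷_; _++_; map; length; concatMap; upTo; applyUpTo; filter; deduplicate)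
import Data.List.Properties as ListP
open import Data.List.Membership.Propositional using (_∈_; find; lose)
import Data.List.Membership.Propositional.Properties as ∈P
open import Data.List.Relation.Binary.Subset.Propositional using (_⊆_)
open import Data.List.Relation.Unary.Any using (here; there)
import Data.List.Relation.Unary.All as All
import Data.List.Relation.Unary.All.Properties as AllP
open import Data.List.Relation.Unary.AllPairs using ([]; _∷_)
open import Data.List.Relation.Unary.Unique.Propositional using (Unique)
import Data.List.Relation.Unary.Unique.Propositional.Properties as UniqueP
import Data.List.Relation.Unary.Unique.DecPropositional.Properties as DecUniqueP
open import Data.Vec as Vec using (Vec; []; _∷_; lookup)
import Data.Vec.Properties as VecP
import Data.Vec.Functional as Vector
import Data.Vec.Functional.Properties as VectorP
open import Function using (_∘_)
open import Relation.Nullary using (¬_; Dec; yes; no)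
open import Relation.Nullary.Decidable using (¬?; decidable-stable)
open import Relation.Nullary.Negation using (DoubleNegation; ¬¬-map)
open import Relation.Unary using (Decidable)
open import Relation.Binary.PropositionalEquality

open import Algebra.Properties.Semiring.Sum ℤP.+-*-semiring
  using (sum; sum-cong-≗; ∑-distrib-+; *-distribˡ-sum; *-distribʳ-sum; sum-remove; sum-replicate-zero)

-- Integer linear algebra in ℤ^d

module _ where
  open import Data.Integer using (_+_; _*_; -_)
  open ℤSolver using (solve-∀)

  sum-neg : ∀ {n} (f : Fin n → ℤ) → sum (λ i → - f i) ≡ - sum f
  sum-neg {zero} f = refl
  sum-neg {suc n} f = trans (cong (_+_ (- f zero)) (sum-neg (f ∘ suc))) (sym (ℤP.neg-distrib-+ (f zero) _))

  sum-single : ∀ {n} (f : Fin n → ℤ) (l : Fin n) → (∀ m → m ≢ l → f m ≡ + 0) → sum f ≡ f l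
  sum-single {suc n} f l f≡0 = begin
    sum f                      ≡⟨ sum-remove {i = l} f ⟩
    f l + sum (f ∘ punchIn l)  ≡⟨ cong (_+_ (f l)) (sum-cong-≗ {n} (λ m → f≡0 (punchIn l m) (FinP.punchInᵢ≢i l m))) ⟩
    f l + sum {n} (λ _ → + 0)  ≡⟨ cong (_+_ (f l)) (sum-replicate-zero n) ⟩
    f l + + 0                  ≡⟨ ℤP.+-identityʳ (f l) ⟩
    f l                        ∎
    where open ≡-Reasoning

  sum-↑ : ∀ m {n} (f : Fin (m ℕ.+ n) → ℤ) → sum f ≡ sum (λ i → f (i ↑ˡ n)) + sum (λ j → f (m ↑ʳ j))
  sum-↑ zero f = sym (ℤP.+-identityˡ _)
  sum-↑ (suc m) f = trans (cong (_+_ (f zero)) (sum-↑ m (f ∘ suc))) (sym (ℤP.+-assoc (f zero) _ _))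

  lookup-ext : ∀ {d} {u v : V d} → (∀ p → lookup u p ≡ lookup v p) → u ≡ v
  lookup-ext {u = u} {v} h = trans (sym (VecP.tabulate∘lookup u)) (trans (VecP.tabulate-cong h) (VecP.tabulate∘lookup v))

  lookup-0v : ∀ {d} (p : Fin d) → lookup (0v {d}) p ≡ + 0
  lookup-0v p = VecP.lookup-replicate p _

  lookup-+v : ∀ {d} (u v : V d) p → lookup (u +v v) p ≡ lookup u p + lookup v p
  lookup-+v u v p = VecP.lookup-zipWith _ p u v

  lookup--v : ∀ {d} (u : V d) p → lookup (-v u) p ≡ - lookup u p
  lookup--v u p = VecP.lookup-map p _ u

  lookup-·v : ∀ {d} (a : ℤ) (u : V d) p → lookup (a ·v u) p ≡ a * lookup u p
  lookup-·v a u p = VecP.lookup-map p _ u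

  lookup-lincomb : ∀ {d r} (a : Fin r → ℤ) (e : Fin r → V d) p →
    lookup (lincomb a e) p ≡ sum (λ j → a j * lookup (e j) p)
  lookup-lincomb {r = zero} a e p = lookup-0v p
  lookup-lincomb {r = suc r} a e p =
    trans (lookup-+v (a zero ·v e zero) (lincomb (a ∘ suc) (e ∘ suc)) p)
          (cong₂ _+_ (lookup-·v (a zero) (e zero) p) (lookup-lincomb (a ∘ suc) (e ∘ suc) p))

  lookup-sumV : ∀ {d t} (v : Fin t → V d) p → lookup (sumV v) p ≡ sum (λ i → lookup (v i) p)
  lookup-sumV {t = zero} v p = lookup-0v p
  lookup-sumV {t = suc t} v p = trans (lookup-+v (v zero) (sumV (v ∘ suc)) p) (cong (_+_ (lookup (v zero) p)) (lookup-sumV (v ∘ suc) p))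

  lincomb-cong : ∀ {d r} {a a' : Fin r → ℤ} {e e' : Fin r → V d} →
    (∀ j → a j ≡ a' j) → (∀ j → e j ≡ e' j) → lincomb a e ≡ lincomb a' e'
  lincomb-cong {r = zero} ha he = refl
  lincomb-cong {r = suc r} ha he = cong₂ _+v_ (cong₂ _·v_ (ha zero) (he zero)) (lincomb-cong (ha ∘ suc) (he ∘ suc))

  lincomb-zero : ∀ {d r} (e : Fin r → V d) → lincomb (λ _ → + 0) e ≡ 0v
  lincomb-zero {r = r} e = lookup-ext λ p → trans (lookup-lincomb (λ _ → + 0) e p) (trans (sum-replicate-zero r) (sym (lookup-0v p)))

  sumV-cong : ∀ {d t} {v w : Fin t → V d} → (∀ i → v i ≡ w i) → sumV v ≡ sumV w
  sumV-cong {t = zero} h = refl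
  sumV-cong {t = suc t} h = cong₂ _+v_ (h zero) (sumV-cong (h ∘ suc))

  +v--v : ∀ {d} (u v : V d) → (u +v (-v v)) +v v ≡ u
  +v--v u v = lookup-ext λ p → begin
    lookup ((u +v (-v v)) +v v) p            ≡⟨ lookup-+v (u +v (-v v)) v p ⟩
    lookup (u +v (-v v)) p + lookup v p      ≡⟨ cong (_+ lookup v p) (lookup-+v u (-v v) p) ⟩
    lookup u p + lookup (-v v) p + lookup v p ≡⟨ cong (λ z → lookup u p + z + lookup v p) (lookup--v v p) ⟩
    lookup u p + - lookup v p + lookup v p   ≡⟨ cancel (lookup u p) (lookup v p) ⟩
    lookup u p                               ∎
    where
    open ≡-Reasoning
    cancel : ∀ a b → a + - b + b ≡ a
    cancel = solve-∀

  dot : ∀ {d} → V d → V d → ℤ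
  dot u v = sum (λ p → lookup u p * lookup v p)

  dot-+ʳ : ∀ {d} (l u v : V d) → dot l (u +v v) ≡ dot l u + dot l v
  dot-+ʳ {d} l u v =
    trans (sum-cong-≗ {d} (λ p → trans (cong (lookup l p *_) (lookup-+v u v p)) (ℤP.*-distribˡ-+ (lookup l p) (lookup u p) (lookup v p))))
          (∑-distrib-+ (λ p → lookup l p * lookup u p) (λ p → lookup l p * lookup v p))

  dot-+ˡ : ∀ {d} (l m v : V d) → dot (l +v m) v ≡ dot l v + dot m v
  dot-+ˡ {d} l m v =
    trans (sum-cong-≗ {d} (λ p → trans (cong (_* lookup v p) (lookup-+v l m p)) (ℤP.*-distribʳ-+ (lookup v p) (lookup l p) (lookup m p))))
          (∑-distrib-+ (λ p → lookup l p * lookup v p) (λ p → lookup m p * lookup v p))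

  dot--ʳ : ∀ {d} (l u : V d) → dot l (-v u) ≡ - dot l u
  dot--ʳ {d} l u =
    trans (sum-cong-≗ {d} (λ p → trans (cong (lookup l p *_) (lookup--v u p)) (sym (ℤP.neg-distribʳ-* (lookup l p) (lookup u p)))))
          (sum-neg (λ p → lookup l p * lookup u p))

  dot--ˡ : ∀ {d} (l u : V d) → dot (-v l) u ≡ - dot l u
  dot--ˡ {d} l u =
    trans (sum-cong-≗ {d} (λ p → trans (cong (_* lookup u p) (lookup--v l p)) (sym (ℤP.neg-distribˡ-* (lookup l p) (lookup u p)))))
          (sum-neg (λ p → lookup l p * lookup u p))

  dot-·ʳ : ∀ {d} (l : V d) a (u : V d) → dot l (a ·v u) ≡ a * dot l u
  dot-·ʳ {d} l a u =
    trans (sum-cong-≗ {d} (λ p → trans (cong (lookup l p *_) (lookup-·v a u p)) (swap (lookup l p) a (lookup u p))))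
          (sym (*-distribˡ-sum a (λ p → lookup l p * lookup u p)))
    where
    swap : ∀ x y z → x * (y * z) ≡ y * (x * z)
    swap = solve-∀

  dot-·ˡ : ∀ {d} a (l u : V d) → dot (a ·v l) u ≡ a * dot l u
  dot-·ˡ {d} a l u =
    trans (sum-cong-≗ {d} (λ p → trans (cong (_* lookup u p) (lookup-·v a l p)) (ℤP.*-assoc a (lookup l p) (lookup u p))))
          (sym (*-distribˡ-sum a (λ p → lookup l p * lookup u p)))

  dot-0ʳ : ∀ {d} (l : V d) → dot l 0v ≡ + 0
  dot-0ʳ {d} l = trans (sum-cong-≗ {d} (λ p → trans (cong (lookup l p *_) (lookup-0v p)) (ℤP.*-zeroʳ (lookup l p)))) (sum-replicate-zero d)

  dot-0ˡ : ∀ {d} (u : V d) → dot 0v u ≡ + 0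
  dot-0ˡ {d} u = trans (sum-cong-≗ {d} (λ p → cong (_* lookup u p) (lookup-0v p))) (sum-replicate-zero d)

  dot-lincombʳ : ∀ {d r} (l : V d) (a : Fin r → ℤ) (e : Fin r → V d) → dot l (lincomb a e) ≡ sum (λ j → a j * dot l (e j))
  dot-lincombʳ {r = zero} l a e = dot-0ʳ l
  dot-lincombʳ {r = suc r} l a e =
    trans (dot-+ʳ l (a zero ·v e zero) (lincomb (a ∘ suc) (e ∘ suc)))
          (cong₂ _+_ (dot-·ʳ l (a zero) (e zero)) (dot-lincombʳ l (a ∘ suc) (e ∘ suc)))

  dot-lincombˡ : ∀ {d r} (a : Fin r → ℤ) (e : Fin r → V d) (u : V d) → dot (lincomb a e) u ≡ sum (λ j → a j * dot (e j) u)
  dot-lincombˡ {r = zero} a e u = dot-0ˡ u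
  dot-lincombˡ {r = suc r} a e u =
    trans (dot-+ˡ (a zero ·v e zero) (lincomb (a ∘ suc) (e ∘ suc)) u)
          (cong₂ _+_ (dot-·ˡ (a zero) (e zero) u) (dot-lincombˡ (a ∘ suc) (e ∘ suc) u))

  unit : ∀ {d} → Fin d → V d
  unit {suc d} zero = + 1 ∷ 0v
  unit {suc d} (suc m) = + 0 ∷ unit m

  dot-unit : ∀ {d} (m : Fin d) (x : V d) → dot (unit m) x ≡ lookup x m
  dot-unit {suc d} zero (b ∷ x) = trans (cong (_+_ (+ 1 * b)) (dot-0ˡ x)) (trans (ℤP.+-identityʳ _) (ℤP.*-identityˡ b))
  dot-unit {suc d} (suc m) (b ∷ x) = trans (ℤP.+-identityˡ _) (dot-unit m x)

  i*j≡0⇒j≡0 : ∀ {i j : ℤ} → i ≢ + 0 → i * j ≡ + 0 → j ≡ + 0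
  i*j≡0⇒j≡0 {i} i≢0 ij≡0 with ℤP.i*j≡0⇒i≡0∨j≡0 i ij≡0
  ... | inj₁ i≡0 = ⊥-elim (i≢0 i≡0)
  ... | inj₂ j≡0 = j≡0

  i≢0∧j≢0⇒i*j≢0 : ∀ {i j : ℤ} → i ≢ + 0 → j ≢ + 0 → i * j ≢ + 0
  i≢0∧j≢0⇒i*j≢0 {i} i≢0 j≢0 ij≡0 with ℤP.i*j≡0⇒i≡0∨j≡0 i ij≡0
  ... | inj₁ i≡0 = i≢0 i≡0
  ... | inj₂ j≡0 = j≢0 j≡0

  m≢0∧n≢0⇒m*n≢0 : ∀ {m n : ℕ} → m ≢ 0 → n ≢ 0 → m ℕ.* n ≢ 0
  m≢0∧n≢0⇒m*n≢0 {m} m≢0 n≢0 mn≡0 with ℕP.m*n≡0⇒m≡0∨n≡0 m mn≡0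
  ... | inj₁ m≡0 = m≢0 m≡0
  ... | inj₂ n≡0 = n≢0 n≡0

  i*i≡+∣i∣*∣i∣ : ∀ i → i * i ≡ + (ℤ.∣ i ∣ ℕ.* ℤ.∣ i ∣)
  i*i≡+∣i∣*∣i∣ (+ n) = sym (ℤP.pos-* n n)
  i*i≡+∣i∣*∣i∣ -[1+ n ] = refl

  a+b≡0⇒a≡-b : ∀ a b → a + b ≡ + 0 → a ≡ - b
  a+b≡0⇒a≡-b a b a+b≡0 = trans (sym (cancel a b)) (trans (cong (_+ - b) a+b≡0) (ℤP.+-identityˡ (- b)))
    where
    cancel : ∀ a b → a + b + - b ≡ a
    cancel = solve-∀

  LinIndep-tail : ∀ {d r} (f : Fin (suc r) → V d) → LinIndep f → LinIndep (f ∘ suc)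
  LinIndep-tail f indep a a·f≡0 j = indep a₀ a₀·f≡0 (suc j)
    where
    a₀ : Fin _ → ℤ
    a₀ zero = + 0
    a₀ (suc j) = a j
    a₀·f≡0 : lincomb a₀ f ≡ 0v
    a₀·f≡0 = lookup-ext λ p →
      trans (lookup-+v ((+ 0) ·v f zero) (lincomb a (f ∘ suc)) p)
            (trans (cong₂ _+_ (lookup-·v (+ 0) (f zero) p) (cong (λ v → lookup v p) a·f≡0))
                   (trans (cong (_+_ (+ 0)) (lookup-0v p)) (sym (lookup-0v p))))

  -- Over ℤ a dual basis exists only up to a common factor D.
  record DualBasis {d R : ℕ} (E : Fin R → V d) : Set where
    field
      D      : ℕ
      D≢0    : D ≢ 0
      Λ      : Fin R → V d
      Λ-diag : ∀ l → dot (Λ l) (E l) ≡ + D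
      Λ-off  : ∀ l m → l ≢ m → dot (Λ l) (E m) ≡ + 0

    dot-Λ-lincomb : ∀ (b : Fin R → ℤ) l → dot (Λ l) (lincomb b E) ≡ b l * + D
    dot-Λ-lincomb b l =
      trans (dot-lincombʳ (Λ l) b E)
            (trans (sum-single (λ m → b m * dot (Λ l) (E m)) l
                               (λ m m≢l → trans (cong (b m *_) (Λ-off l m (m≢l ∘ sym))) (ℤP.*-zeroʳ (b m))))
                   (cong (b l *_) (Λ-diag l)))

  -- Given a dual basis Λ' of E' = E ∘ suc, each μ m = D' eₘ − Σⱼ (E' j)ₘ Λ' j annihilates E'.
  -- If all μ m also annihilate E 0, then D' E 0 = Σⱼ (Λ' j · E 0) E' j contradicts independence;
  -- otherwise μ m with α = μ m · E 0 ≠ 0 is the new functional for E 0 and α Λ' j − (Λ' j · E 0) μ m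
  -- those for E' j, all rescaled to the common factor α² D'.
  dualBasis : ∀ {d} R (E : Fin R → V d) → LinIndep E → DualBasis E
  dualBasis zero E _ = record { D = 1 ; D≢0 = λ () ; Λ = λ () ; Λ-diag = λ () ; Λ-off = λ () }
  dualBasis {d} (suc R) E indep = extend (FinP.any? (λ m → ¬? (dot (μ m) (E zero) ℤ.≟ + 0)))
    where
    E' : Fin R → V d
    E' = E ∘ suc
    module IH = DualBasis (dualBasis R E' (LinIndep-tail E indep))
    D' : ℕ
    D' = IH.D
    c : Fin R → ℤ
    c j = dot (IH.Λ j) (E zero)
    μ : Fin d → V d
    μ m = ((+ D') ·v unit m) +v (-v lincomb (λ j → lookup (E' j) m) IH.Λ)

    dot-μ : ∀ m x → dot (μ m) x ≡ + D' * lookup x m + - sum (λ j → lookup (E' j) m * dot (IH.Λ j) x)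
    dot-μ m x =
      trans (dot-+ˡ ((+ D') ·v unit m) (-v lincomb (λ j → lookup (E' j) m) IH.Λ) x)
            (cong₂ _+_ (trans (dot-·ˡ (+ D') (unit m) x) (cong (+ D' *_) (dot-unit m x)))
                       (trans (dot--ˡ (lincomb (λ j → lookup (E' j) m) IH.Λ) x)
                              (cong -_ (dot-lincombˡ (λ j → lookup (E' j) m) IH.Λ x))))

    μ-E' : ∀ m k → dot (μ m) (E' k) ≡ + 0
    μ-E' m k =
      trans (dot-μ m (E' k))
            (trans (cong (λ s → + D' * lookup (E' k) m + - s)
                         (trans (sum-single (λ j → lookup (E' j) m * dot (IH.Λ j) (E' k)) k
                                  (λ j j≢k → trans (cong (lookup (E' j) m *_) (IH.Λ-off j k j≢k)) (ℤP.*-zeroʳ (lookup (E' j) m))))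
                                (cong (lookup (E' k) m *_) (IH.Λ-diag k))))
                   (cancel (+ D') (lookup (E' k) m)))
      where
      cancel : ∀ a x → a * x + - (x * a) ≡ + 0
      cancel = solve-∀

    extend : Dec (∃ λ m → dot (μ m) (E zero) ≢ + 0) → DualBasis E
    extend (no none) = ⊥-elim (IH.D≢0 (ℤP.+-injective (indep a a·E≡0 zero)))
      where
      μ-E₀ : ∀ m → dot (μ m) (E zero) ≡ + 0
      μ-E₀ m with dot (μ m) (E zero) ℤ.≟ + 0
      ... | yes μE₀≡0 = μE₀≡0
      ... | no μE₀≢0 = ⊥-elim (none (m , μE₀≢0))
      a : Fin (suc R) → ℤ
      a zero = + D'
      a (suc j) = - c j
      a·E≡0 : lincomb a E ≡ 0v
      a·E≡0 = lookup-ext λ p →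
        trans (lookup-+v ((+ D') ·v E zero) (lincomb (a ∘ suc) E') p)
        (trans (cong₂ _+_ (lookup-·v (+ D') (E zero) p)
                          (trans (lookup-lincomb (a ∘ suc) E' p)
                          (trans (sum-cong-≗ {R} (λ j → trans (sym (ℤP.neg-distribˡ-* (c j) (lookup (E' j) p))) (cong -_ (ℤP.*-comm (c j) (lookup (E' j) p)))))
                                 (sum-neg (λ j → lookup (E' j) p * c j)))))
        (trans (sym (dot-μ p (E zero))) (trans (μ-E₀ p) (sym (lookup-0v p)))))
    extend (yes (m , α≢0)) = record { D = D ; D≢0 = D≢0 ; Λ = Λ ; Λ-diag = Λ-diag ; Λ-off = Λ-off }
      where
      α : ℤ
      α = dot (μ m) (E zero)
      D : ℕ
      D = ℤ.∣ α ∣ ℕ.* ℤ.∣ α ∣ ℕ.* D'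
      ∣α∣≢0 : ℤ.∣ α ∣ ≢ 0
      ∣α∣≢0 = α≢0 ∘ ℤP.∣i∣≡0⇒i≡0
      D≢0 : D ≢ 0
      D≢0 = m≢0∧n≢0⇒m*n≢0 (m≢0∧n≢0⇒m*n≢0 ∣α∣≢0 ∣α∣≢0) IH.D≢0
      +D≡α*α*D' : + D ≡ α * α * + D'
      +D≡α*α*D' = trans (ℤP.pos-* (ℤ.∣ α ∣ ℕ.* ℤ.∣ α ∣) D') (cong (_* + D') (sym (i*i≡+∣i∣*∣i∣ α)))
      Λ : Fin (suc R) → V d
      Λ zero = (α * + D') ·v μ m
      Λ (suc j) = α ·v ((α ·v IH.Λ j) +v (-v (c j ·v μ m)))
      dot-Λ-suc : ∀ j x → dot (Λ (suc j)) x ≡ α * (α * dot (IH.Λ j) x + - (c j * dot (μ m) x))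
      dot-Λ-suc j x =
        trans (dot-·ˡ α ((α ·v IH.Λ j) +v (-v (c j ·v μ m))) x)
              (cong (α *_) (trans (dot-+ˡ (α ·v IH.Λ j) (-v (c j ·v μ m)) x)
                                  (cong₂ _+_ (dot-·ˡ α (IH.Λ j) x) (trans (dot--ˡ (c j ·v μ m) x) (cong -_ (dot-·ˡ (c j) (μ m) x))))))
      ring₁ : ∀ a D → a * D * a ≡ a * a * D
      ring₁ = solve-∀
      ring₂ : ∀ a D c → a * (a * D + - (c * + 0)) ≡ a * a * D
      ring₂ = solve-∀
      ring₃ : ∀ a c → a * (a * c + - (c * a)) ≡ + 0
      ring₃ = solve-∀
      ring₄ : ∀ a c → a * (a * + 0 + - (c * + 0)) ≡ + 0
      ring₄ = solve-∀
      Λ-diag : ∀ l → dot (Λ l) (E l) ≡ + D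
      Λ-diag zero = trans (dot-·ˡ (α * + D') (μ m) (E zero)) (trans (ring₁ α (+ D')) (sym +D≡α*α*D'))
      Λ-diag (suc j) =
        trans (dot-Λ-suc j (E' j))
              (trans (cong₂ (λ u v → α * (α * u + - (c j * v))) (IH.Λ-diag j) (μ-E' m j))
                     (trans (ring₂ α (+ D') (c j)) (sym +D≡α*α*D')))
      Λ-off : ∀ l k → l ≢ k → dot (Λ l) (E k) ≡ + 0
      Λ-off zero zero 0≢0 = ⊥-elim (0≢0 refl)
      Λ-off zero (suc k) _ = trans (dot-·ˡ (α * + D') (μ m) (E' k)) (trans (cong ((α * + D') *_) (μ-E' m k)) (ℤP.*-zeroʳ (α * + D')))
      Λ-off (suc j) zero _ = trans (dot-Λ-suc j (E zero)) (ring₃ α (c j))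
      Λ-off (suc j) (suc k) j≢k =
        trans (dot-Λ-suc j (E' k))
              (trans (cong₂ (λ u v → α * (α * u + - (c j * v))) (IH.Λ-off j k (j≢k ∘ cong suc)) (μ-E' m k))
                     (ring₄ α (c j)))

  record InRatSpan {d m} (g : Fin m → V d) (w : V d) : Set where
    constructor ratSpan
    field
      scale   : ℤ
      scale≢0 : scale ≢ + 0
      coeffs  : Fin m → ℤ
      scaled  : scale ·v w ≡ lincomb coeffs g

    lookup-scaled : ∀ p → scale * lookup w p ≡ sum (λ l → coeffs l * lookup (g l) p)
    lookup-scaled p = trans (sym (lookup-·v scale w p)) (trans (cong (λ v → lookup v p) scaled) (lookup-lincomb coeffs g p))

  module Elimination {d m} (g : Fin (suc m) → V d) (f : Fin (suc (suc m)) → V d)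
                     (f∈span : ∀ k → InRatSpan g (f k)) where
    open InRatSpan

    C : Fin (suc (suc m)) → ℤ
    C k = scale (f∈span k)
    b : Fin (suc (suc m)) → Fin (suc m) → ℤ
    b k = coeffs (f∈span k)
    B : Fin (suc (suc m)) → ℤ
    B k = b k zero
    G : Fin d → Fin (suc m) → ℤ
    G p l = lookup (g l) p
    S : Fin (suc (suc m)) → Fin d → ℤ
    S k p = sum (λ l → b k (suc l) * G p (suc l))

    lookup-Cf : ∀ k p → C k * lookup (f k) p ≡ B k * G p zero + S k p
    lookup-Cf k p = lookup-scaled (f∈span k) p

    span-without-g₀ : ∀ k → B k ≡ + 0 → InRatSpan (g ∘ suc) (f k)
    span-without-g₀ k Bk≡0 = ratSpan (C k) (scale≢0 (f∈span k)) (b k ∘ suc) (lookup-ext λ p →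
      trans (lookup-·v (C k) (f k) p)
            (trans (lookup-Cf k p)
                   (trans (cong (λ x → x * G p zero + S k p) Bk≡0)
                          (trans (ℤP.+-identityˡ _) (sym (lookup-lincomb (b k ∘ suc) (g ∘ suc) p))))))

    -- Cross-multiplying every other f k against a pivot f k₀ with B k₀ ≠ 0 cancels the g zero-components.
    module Pivot (k₀ : Fin (suc (suc m))) (B≢0 : B k₀ ≢ + 0) where
      w : ℤ
      w = B k₀
      k' : Fin (suc m) → Fin (suc (suc m))
      k' k = punchIn k₀ k
      W : Fin (suc m) → ℤ
      W k = w * C (k' k)
      U : Fin (suc m) → ℤ
      U k = B (k' k) * C k₀
      f' : Fin (suc m) → V d
      f' k = (W k ·v f (k' k)) +v (-v (U k ·v f k₀))

      lookup-f' : ∀ k p → lookup (f' k) p ≡ W k * lookup (f (k' k)) p + - (U k * lookup (f k₀) p)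
      lookup-f' k p =
        trans (lookup-+v (W k ·v f (k' k)) (-v (U k ·v f k₀)) p)
              (cong₂ _+_ (lookup-·v (W k) (f (k' k)) p) (trans (lookup--v (U k ·v f k₀) p) (cong -_ (lookup-·v (U k) (f k₀) p))))

      f'∈span : ∀ k → InRatSpan (g ∘ suc) (f' k)
      f'∈span k = ratSpan (+ 1) (λ ()) bn (lookup-ext λ p → begin
          lookup ((+ 1) ·v f' k) p
            ≡⟨ lookup-·v (+ 1) (f' k) p ⟩
          + 1 * lookup (f' k) p
            ≡⟨ cong (+ 1 *_) (lookup-f' k p) ⟩
          + 1 * (W k * lookup (f (k' k)) p + - (U k * lookup (f k₀) p))
            ≡⟨ ring₁ w (C (k' k)) (lookup (f (k' k)) p) (B (k' k)) (C k₀) (lookup (f k₀) p) ⟩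
          w * (C (k' k) * lookup (f (k' k)) p) + - (B (k' k) * (C k₀ * lookup (f k₀) p))
            ≡⟨ cong₂ (λ u v → w * u + - (B (k' k) * v)) (lookup-Cf (k' k) p) (lookup-Cf k₀ p) ⟩
          w * (B (k' k) * G p zero + S (k' k) p) + - (B (k' k) * (w * G p zero + S k₀ p))
            ≡⟨ ring₂ w (B (k' k)) (G p zero) (S (k' k) p) (S k₀ p) ⟩
          w * S (k' k) p + - (B (k' k) * S k₀ p)
            ≡⟨ cong₂ _+_ (*-distribˡ-sum w (λ l → b (k' k) (suc l) * G p (suc l)))
                         (trans (cong -_ (*-distribˡ-sum (B (k' k)) (λ l → b k₀ (suc l) * G p (suc l))))
                                (sym (sum-neg (λ l → B (k' k) * (b k₀ (suc l) * G p (suc l)))))) ⟩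
          sum (λ l → w * (b (k' k) (suc l) * G p (suc l))) + sum (λ l → - (B (k' k) * (b k₀ (suc l) * G p (suc l))))
            ≡⟨ sym (∑-distrib-+ (λ l → w * (b (k' k) (suc l) * G p (suc l))) (λ l → - (B (k' k) * (b k₀ (suc l) * G p (suc l))))) ⟩
          sum (λ l → w * (b (k' k) (suc l) * G p (suc l)) + - (B (k' k) * (b k₀ (suc l) * G p (suc l))))
            ≡⟨ sum-cong-≗ {m} (λ l → ring₃ w (b (k' k) (suc l)) (B (k' k)) (b k₀ (suc l)) (G p (suc l))) ⟩
          sum (λ l → bn l * G p (suc l))
            ≡⟨ sym (lookup-lincomb bn (g ∘ suc) p) ⟩
          lookup (lincomb bn (g ∘ suc)) p ∎)
        where
        open ≡-Reasoning
        bn : Fin m → ℤ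
        bn l = w * b (k' k) (suc l) + - (B (k' k) * b k₀ (suc l))
        ring₁ : ∀ w c' X B' c₀ Y → + 1 * (w * c' * X + - (B' * c₀ * Y)) ≡ w * (c' * X) + - (B' * (c₀ * Y))
        ring₁ = solve-∀
        ring₂ : ∀ w B' G₀ S' S₀ → w * (B' * G₀ + S') + - (B' * (w * G₀ + S₀)) ≡ w * S' + - (B' * S₀)
        ring₂ = solve-∀
        ring₃ : ∀ w x B y G → w * (x * G) + - (B * (y * G)) ≡ (w * x + - (B * y)) * G
        ring₃ = solve-∀

      -- A relation Σ α k f' k = 0 is a relation among the f with the coefficient α k W k at k₀↑k.
      f'-indep : LinIndep f → LinIndep f'
      f'-indep indep α α·f'≡0 k =
        i*j≡0⇒j≡0 (i≢0∧j≢0⇒i*j≢0 B≢0 (scale≢0 (f∈span (k' k))))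
                  (trans (ℤP.*-comm (W k) (α k)) (trans (sym (α₀-punchIn k)) (indep α₀ α₀·f≡0 (k' k))))
        where
        α₀ : Fin (suc (suc m)) → ℤ
        α₀ i with k₀ FinP.≟ i
        ... | yes _ = - sum (λ k → α k * U k)
        ... | no k₀≢i = α (punchOut k₀≢i) * W (punchOut k₀≢i)
        α₀-punchIn : ∀ k → α₀ (k' k) ≡ α k * W k
        α₀-punchIn k with k₀ FinP.≟ k' k
        ... | yes k₀≡ = ⊥-elim (FinP.punchInᵢ≢i k₀ k (sym k₀≡))
        ... | no _ = cong (λ j → α j * W j) (trans (FinP.punchOut-cong k₀ refl) (FinP.punchOut-punchIn k₀))
        α₀-k₀ : α₀ k₀ ≡ - sum (λ k → α k * U k)
        α₀-k₀ with k₀ FinP.≟ k₀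
        ... | yes _ = refl
        ... | no k₀≢k₀ = ⊥-elim (k₀≢k₀ refl)
        ring₁ : ∀ a W X U Y → a * (W * X + - (U * Y)) ≡ a * W * X + - (a * U * Y)
        ring₁ = solve-∀
        ring₂ : ∀ (s y t : ℤ) → - s * y + t ≡ t + - (s * y)
        ring₂ = solve-∀
        Y : Fin d → ℤ
        Y = λ p → lookup (f k₀) p
        X : Fin d → Fin (suc m) → ℤ
        X = λ p k → lookup (f (k' k)) p
        α₀·f≡0 : lincomb α₀ f ≡ 0v
        α₀·f≡0 = lookup-ext λ p → begin
          lookup (lincomb α₀ f) p
            ≡⟨ lookup-lincomb α₀ f p ⟩
          sum (λ i → α₀ i * lookup (f i) p)
            ≡⟨ sum-remove {i = k₀} (λ i → α₀ i * lookup (f i) p) ⟩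
          α₀ k₀ * Y p + sum (λ k → α₀ (k' k) * X p k)
            ≡⟨ cong₂ _+_ (cong (_* Y p) α₀-k₀) (sum-cong-≗ {suc m} (λ k → cong (_* X p k) (α₀-punchIn k))) ⟩
          - sum (λ k → α k * U k) * Y p + sum (λ k → α k * W k * X p k)
            ≡⟨ ring₂ (sum (λ k → α k * U k)) (Y p) _ ⟩
          sum (λ k → α k * W k * X p k) + - (sum (λ k → α k * U k) * Y p)
            ≡⟨ cong (λ z → sum (λ k → α k * W k * X p k) + - z) (*-distribʳ-sum (Y p) (λ k → α k * U k)) ⟩
          sum (λ k → α k * W k * X p k) + - sum (λ k → α k * U k * Y p)
            ≡⟨ cong (_+_ (sum (λ k → α k * W k * X p k))) (sym (sum-neg (λ k → α k * U k * Y p))) ⟩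
          sum (λ k → α k * W k * X p k) + sum (λ k → - (α k * U k * Y p))
            ≡⟨ sym (∑-distrib-+ (λ k → α k * W k * X p k) (λ k → - (α k * U k * Y p))) ⟩
          sum (λ k → α k * W k * X p k + - (α k * U k * Y p))
            ≡⟨ sym (sum-cong-≗ {suc m} (λ k → trans (cong (α k *_) (lookup-f' k p)) (ring₁ (α k) (W k) (X p k) (U k) (Y p)))) ⟩
          sum (λ k → α k * lookup (f' k) p)
            ≡⟨ sym (lookup-lincomb α f' p) ⟩
          lookup (lincomb α f') p
            ≡⟨ cong (λ v → lookup v p) α·f'≡0 ⟩
          lookup 0v p ∎
          where open ≡-Reasoning

  steinitz : ∀ {d} m (g : Fin m → V d) (f : Fin (suc m) → V d) → (∀ k → InRatSpan g (f k)) → ¬ LinIndep f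
  steinitz zero g f f∈span indep = 1≢0 (indep (λ _ → + 1) 1·f≡0 zero)
    where
    open InRatSpan (f∈span zero)
    1≢0 : + 1 ≢ + 0
    1≢0 ()
    f₀≡0 : ∀ p → lookup (f zero) p ≡ + 0
    f₀≡0 p = i*j≡0⇒j≡0 scale≢0 (lookup-scaled p)
    1·f≡0 : lincomb (λ _ → + 1) f ≡ 0v
    1·f≡0 = lookup-ext λ p →
      trans (lookup-+v ((+ 1) ·v f zero) 0v p)
            (trans (cong₂ _+_ (trans (lookup-·v (+ 1) (f zero) p) (trans (ℤP.*-identityˡ _) (f₀≡0 p))) (lookup-0v p))
                   (sym (lookup-0v p)))
  steinitz (suc m) g f f∈span indep = eliminate (FinP.any? (λ k → ¬? (E.B k ℤ.≟ + 0)))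
    where
    module E = Elimination g f f∈span
    eliminate : Dec (∃ λ k → E.B k ≢ + 0) → ⊥
    eliminate (no none) = steinitz m (g ∘ suc) (f ∘ suc) (λ k → E.span-without-g₀ (suc k) (B≡0 (suc k))) (LinIndep-tail f indep)
      where
      B≡0 : ∀ k → E.B k ≡ + 0
      B≡0 k with E.B k ℤ.≟ + 0
      ... | yes Bk≡0 = Bk≡0
      ... | no Bk≢0 = ⊥-elim (none (k , Bk≢0))
    eliminate (yes (k₀ , B≢0)) = steinitz m (g ∘ suc) P.f' P.f'∈span (P.f'-indep indep)
      where module P = E.Pivot k₀ B≢0

  InRatSpan-0 : ∀ {d m} (g : Fin m → V d) → InRatSpan g 0v
  InRatSpan-0 g = ratSpan (+ 1) (λ ()) (λ _ → + 0) (lookup-ext λ p →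
    trans (lookup-·v (+ 1) 0v p) (trans (cong (+ 1 *_) (lookup-0v p)) (sym (trans (cong (λ v → lookup v p) (lincomb-zero g)) (lookup-0v p)))))

  InRatSpan-+ : ∀ {d m} (g : Fin m → V d) {u w : V d} → InRatSpan g u → InRatSpan g w → InRatSpan g (u +v w)
  InRatSpan-+ g {u} {w} u∈@(ratSpan cu cu≢0 bu _) w∈@(ratSpan cw cw≢0 bw _) =
    ratSpan (cu * cw) (i≢0∧j≢0⇒i*j≢0 cu≢0 cw≢0) (λ l → cw * bu l + cu * bw l) (lookup-ext λ p → begin
      lookup ((cu * cw) ·v (u +v w)) p
        ≡⟨ trans (lookup-·v (cu * cw) (u +v w) p) (cong ((cu * cw) *_) (lookup-+v u w p)) ⟩
      cu * cw * (lookup u p + lookup w p)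
        ≡⟨ ring₁ cu cw (lookup u p) (lookup w p) ⟩
      cw * (cu * lookup u p) + cu * (cw * lookup w p)
        ≡⟨ cong₂ (λ x y → cw * x + cu * y) (InRatSpan.lookup-scaled u∈ p) (InRatSpan.lookup-scaled w∈ p) ⟩
      cw * sum (λ l → bu l * lookup (g l) p) + cu * sum (λ l → bw l * lookup (g l) p)
        ≡⟨ cong₂ _+_ (*-distribˡ-sum cw (λ l → bu l * lookup (g l) p)) (*-distribˡ-sum cu (λ l → bw l * lookup (g l) p)) ⟩
      sum (λ l → cw * (bu l * lookup (g l) p)) + sum (λ l → cu * (bw l * lookup (g l) p))
        ≡⟨ sym (∑-distrib-+ (λ l → cw * (bu l * lookup (g l) p)) (λ l → cu * (bw l * lookup (g l) p))) ⟩
      sum (λ l → cw * (bu l * lookup (g l) p) + cu * (bw l * lookup (g l) p))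
        ≡⟨ sum-cong-≗ {_} (λ l → ring₂ cw (bu l) cu (bw l) (lookup (g l) p)) ⟩
      sum (λ l → (cw * bu l + cu * bw l) * lookup (g l) p)
        ≡⟨ sym (lookup-lincomb _ g p) ⟩
      lookup (lincomb (λ l → cw * bu l + cu * bw l) g) p ∎)
    where
    open ≡-Reasoning
    ring₁ : ∀ a b x y → a * b * (x + y) ≡ b * (a * x) + a * (b * y)
    ring₁ = solve-∀
    ring₂ : ∀ a x b y z → a * (x * z) + b * (y * z) ≡ (a * x + b * y) * z
    ring₂ = solve-∀

  InRatSpan-· : ∀ {d m} (g : Fin m → V d) (a : ℤ) {w : V d} → InRatSpan g w → InRatSpan g (a ·v w)
  InRatSpan-· g a {w} w∈@(ratSpan c c≢0 b _) = ratSpan c c≢0 (λ l → a * b l) (lookup-ext λ p →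
    trans (lookup-·v c (a ·v w) p)
    (trans (cong (c *_) (lookup-·v a w p))
    (trans (swap c a (lookup w p))
    (trans (cong (a *_) (InRatSpan.lookup-scaled w∈ p))
    (trans (*-distribˡ-sum a (λ l → b l * lookup (g l) p))
    (trans (sum-cong-≗ {_} (λ l → sym (ℤP.*-assoc a (b l) (lookup (g l) p))))
           (sym (lookup-lincomb (λ l → a * b l) g p))))))))
    where
    swap : ∀ c a x → c * (a * x) ≡ a * (c * x)
    swap = solve-∀

  InRatSpan-lincomb : ∀ {d m r} (g : Fin m → V d) (b : Fin r → ℤ) (w : Fin r → V d) →
    (∀ j → InRatSpan g (w j)) → InRatSpan g (lincomb b w)
  InRatSpan-lincomb {r = zero} g b w w∈ = InRatSpan-0 g
  InRatSpan-lincomb {r = suc r} g b w w∈ =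
    InRatSpan-+ g (InRatSpan-· g (b zero) (w∈ zero)) (InRatSpan-lincomb g (b ∘ suc) (w ∘ suc) (w∈ ∘ suc))

  InRatSpan-sumV : ∀ {d m t} (g : Fin m → V d) (v : Fin t → V d) → (∀ i → InRatSpan g (v i)) → InRatSpan g (sumV v)
  InRatSpan-sumV {t = zero} g v v∈ = InRatSpan-0 g
  InRatSpan-sumV {t = suc t} g v v∈ = InRatSpan-+ g (v∈ zero) (InRatSpan-sumV g (v ∘ suc) (v∈ ∘ suc))

  InRatSpan-drop : ∀ {d R} (E : Fin (suc R) → V d) (α : Fin (suc R) → ℤ) (l : Fin (suc R)) →
    lincomb α E ≡ 0v → α l ≢ + 0 → ∀ {w} → InRatSpan E w → InRatSpan (E ∘ punchIn l) w
  InRatSpan-drop {d} {R} E α l α·E≡0 αl≢0 {w} w∈@(ratSpan c c≢0 b _) =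
    ratSpan (α l * c) (i≢0∧j≢0⇒i*j≢0 αl≢0 c≢0) b' (lookup-ext λ p → begin
        lookup ((α l * c) ·v w) p
          ≡⟨ lookup-·v (α l * c) w p ⟩
        α l * c * lookup w p
          ≡⟨ ℤP.*-assoc (α l) c _ ⟩
        α l * (c * lookup w p)
          ≡⟨ cong (α l *_) (InRatSpan.lookup-scaled w∈ p) ⟩
        α l * sum (λ m → b m * Ep p m)
          ≡⟨ cong (α l *_) (sum-remove {i = l} (λ m → b m * Ep p m)) ⟩
        α l * (b l * Ep p l + sum (B p))
          ≡⟨ ring₁ (α l) (b l) (Ep p l) _ ⟩
        b l * (α l * Ep p l) + α l * sum (B p)
          ≡⟨ cong (λ x → b l * x + α l * sum (B p)) (αl·El p) ⟩
        b l * (- sum (A p)) + α l * sum (B p)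
          ≡⟨ cong₂ _+_ (trans (ring₂ (b l) (sum (A p))) (*-distribˡ-sum (- b l) (A p))) (*-distribˡ-sum (α l) (B p)) ⟩
        sum (λ m → - b l * A p m) + sum (λ m → α l * B p m)
          ≡⟨ sym (∑-distrib-+ (λ m → - b l * A p m) (λ m → α l * B p m)) ⟩
        sum (λ m → - b l * A p m + α l * B p m)
          ≡⟨ sum-cong-≗ {R} (λ m → ring₃ (b l) (α (punchIn l m)) (α l) (b (punchIn l m)) (Ep p (punchIn l m))) ⟩
        sum (λ m → b' m * Ep p (punchIn l m))
          ≡⟨ sym (lookup-lincomb b' (E ∘ punchIn l) p) ⟩
        lookup (lincomb b' (E ∘ punchIn l)) p ∎)
    where
    open ≡-Reasoning
    b' : Fin R → ℤ
    b' m = α l * b (punchIn l m) + - (b l * α (punchIn l m))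
    Ep : Fin d → Fin (suc R) → ℤ
    Ep p m = lookup (E m) p
    A B : Fin d → Fin R → ℤ
    A p m = α (punchIn l m) * Ep p (punchIn l m)
    B p m = b (punchIn l m) * Ep p (punchIn l m)
    ring₁ : ∀ a bl el s → a * (bl * el + s) ≡ bl * (a * el) + a * s
    ring₁ = solve-∀
    ring₂ : ∀ x s → x * (- s) ≡ - x * s
    ring₂ = solve-∀
    ring₃ : ∀ bl am al bm e → - bl * (am * e) + al * (bm * e) ≡ (al * bm + - (bl * am)) * e
    ring₃ = solve-∀
    αl·El : ∀ p → α l * Ep p l ≡ - sum (A p)
    αl·El p = a+b≡0⇒a≡-b (α l * Ep p l) _
      (trans (sym (sum-remove {i = l} (λ m → α m * Ep p m)))
      (trans (sym (lookup-lincomb α E p)) (trans (cong (λ v → lookup v p) α·E≡0) (lookup-0v p))))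

  flatten : ∀ {A : Set} {t} (r : Fin t → ℕ) → ((i : Fin t) → Fin (r i) → A) → Fin (sumℕ r) → A
  flatten {t = zero} r e ()
  flatten {t = suc t} r e = e zero Vector.++ flatten (r ∘ suc) (e ∘ suc)

  flatIndex : ∀ {t} (r : Fin t → ℕ) (i : Fin t) → Fin (r i) → Fin (sumℕ r)
  flatIndex {suc t} r zero j = j ↑ˡ sumℕ (r ∘ suc)
  flatIndex {suc t} r (suc i) j = r zero ↑ʳ flatIndex (r ∘ suc) i j

  flatten-flatIndex : ∀ {A : Set} {t} (r : Fin t → ℕ) (e : (i : Fin t) → Fin (r i) → A) i j →
    flatten r e (flatIndex r i j) ≡ e i j
  flatten-flatIndex {t = suc t} r e zero j = VectorP.lookup-++ˡ (e zero) _ j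
  flatten-flatIndex {t = suc t} r e (suc i) j =
    trans (VectorP.lookup-++ʳ (e zero) _ (flatIndex (r ∘ suc) i j)) (flatten-flatIndex (r ∘ suc) (e ∘ suc) i j)

  flatIndex-surjective : ∀ {t} (r : Fin t → ℕ) (l : Fin (sumℕ r)) → ∃ λ i → ∃ λ j → flatIndex r i j ≡ l
  flatIndex-surjective {suc t} r l with splitAt (r zero) l in eq
  ... | inj₁ j = zero , j , trans (cong (join (r zero) _) (sym eq)) (FinP.join-splitAt (r zero) _ l)
  ... | inj₂ l' with flatIndex-surjective (r ∘ suc) l'
  ...   | i , j , ij↦l' = suc i , j , trans (cong (r zero ↑ʳ_) ij↦l') (trans (cong (join (r zero) _) (sym eq)) (FinP.join-splitAt (r zero) _ l))

  flatten-flatIndex⁻¹ : ∀ {A : Set} {t} (r : Fin t → ℕ) (h : Fin (sumℕ r) → A) l →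
    flatten r (λ i j → h (flatIndex r i j)) l ≡ h l
  flatten-flatIndex⁻¹ {t = suc t} r h l with splitAt (r zero) l in eq
  ... | inj₁ j = cong h (trans (cong (join (r zero) _) (sym eq)) (FinP.join-splitAt (r zero) _ l))
  ... | inj₂ j = trans (flatten-flatIndex⁻¹ (r ∘ suc) (λ l' → h (r zero ↑ʳ l')) j)
                       (cong h (trans (cong (join (r zero) _) (sym eq)) (FinP.join-splitAt (r zero) _ l)))

  flatten-map : ∀ {A B : Set} {t} (r : Fin t → ℕ) (f : (i : Fin t) → Fin (r i) → A) (g : A → B) l →
    flatten r (λ i j → g (f i j)) l ≡ g (flatten r f l)
  flatten-map {t = suc t} r f g l with splitAt (r zero) l
  ... | inj₁ j = refl
  ... | inj₂ j = flatten-map (r ∘ suc) (f ∘ suc) g j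

  lincomb-flatten : ∀ {d t} (r : Fin t → ℕ) (a : (i : Fin t) → Fin (r i) → ℤ) (e : (i : Fin t) → Fin (r i) → V d) →
    lincomb (flatten r a) (flatten r e) ≡ sumV (λ i → lincomb (a i) (e i))
  lincomb-flatten r a e = lookup-ext λ p → trans (lookup-lincomb-flatten r a e p) (sym (lookup-sumV (λ i → lincomb (a i) (e i)) p))
    where
    lookup-lincomb-flatten : ∀ {d t} (r : Fin t → ℕ) (a : (i : Fin t) → Fin (r i) → ℤ) (e : (i : Fin t) → Fin (r i) → V d) p →
      lookup (lincomb (flatten r a) (flatten r e)) p ≡ sum (λ i → lookup (lincomb (a i) (e i)) p)
    lookup-lincomb-flatten {t = zero} r a e p = lookup-0v p
    lookup-lincomb-flatten {t = suc t} r a e p =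
      trans (lookup-lincomb (flatten r a) (flatten r e) p)
      (trans (sum-↑ (r zero) (λ l → flatten r a l * lookup (flatten r e l) p))
      (cong₂ _+_ (trans (sum-cong-≗ {r zero} (λ j → cong₂ (λ x v → x * lookup v p) (VectorP.lookup-++ˡ (a zero) _ j) (VectorP.lookup-++ˡ (e zero) _ j)))
                        (sym (lookup-lincomb (a zero) (e zero) p)))
                 (trans (sum-cong-≗ {sumℕ (r ∘ suc)} (λ j → cong₂ (λ x v → x * lookup v p) (VectorP.lookup-++ʳ (a zero) _ j) (VectorP.lookup-++ʳ (e zero) _ j)))
                 (trans (sym (lookup-lincomb (flatten (r ∘ suc) (a ∘ suc)) (flatten (r ∘ suc) (e ∘ suc)) p))
                        (lookup-lincomb-flatten (r ∘ suc) (a ∘ suc) (e ∘ suc) p)))))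

  InRatSpan-flatten : ∀ {d t} (r : Fin t → ℕ) (e : (i : Fin t) → Fin (r i) → V d) (i : Fin t) {w : V d} →
    InRatSpan (e i) w → InRatSpan (flatten r e) w
  InRatSpan-flatten r e i {w} (ratSpan c c≢0 b c·w≡b·e) = ratSpan c c≢0 (flatten r padded) (begin
    c ·v w                                               ≡⟨ c·w≡b·e ⟩
    lincomb b (e i)                                      ≡⟨ sym (sum-single-V) ⟩
    sumV (λ i' → lincomb (padded i') (e i'))             ≡⟨ sym (lincomb-flatten r padded e) ⟩
    lincomb (flatten r padded) (flatten r e)             ∎)
    where
    open ≡-Reasoning
    padded : (i' : Fin _) → Fin (r i') → ℤ
    padded i' with i' FinP.≟ i
    ... | yes refl = b
    ... | no _ = λ _ → + 0
    sum-single-V : sumV (λ i' → lincomb (padded i') (e i')) ≡ lincomb b (e i)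
    sum-single-V = lookup-ext λ p → trans (lookup-sumV (λ i' → lincomb (padded i') (e i')) p) (trans (sum-single _ i (padded-off p)) (cong (λ v → lookup v p) padded-self))
      where
      padded-off : ∀ p i' → i' ≢ i → lookup (lincomb (padded i') (e i')) p ≡ + 0
      padded-off p i' i'≢i with i' FinP.≟ i
      ... | yes i'≡i = ⊥-elim (i'≢i i'≡i)
      ... | no _ = trans (cong (λ v → lookup v p) (lincomb-zero (e i'))) (lookup-0v p)
      padded-self : lincomb (padded i) (e i) ≡ lincomb b (e i)
      padded-self with i FinP.≟ i
      ... | yes refl = refl
      ... | no i≢i = ⊥-elim (i≢i refl)

  ¬¬-∀Fin : ∀ {n} {P : Fin n → Set} → (∀ i → DoubleNegation (P i)) → DoubleNegation (∀ i → P i)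
  ¬¬-∀Fin {zero} ¬¬P ¬∀P = ¬∀P (λ ())
  ¬¬-∀Fin {suc n} {P} ¬¬P ¬∀P =
    ¬¬P zero (λ P₀ → ¬¬-∀Fin {P = P ∘ suc} (¬¬P ∘ suc) (λ P₊ → ¬∀P (λ { zero → P₀ ; (suc i) → P₊ i })))

  -- The maximality clause of HasRank is a negation, so span membership is only obtained doubly negated.
  HasRank⇒InRatSpan : ∀ {d r} (P : V d → Set) → HasRank P r → (e : Fin r → V d) → (∀ j → P (e j)) → LinIndep e →
    ∀ w → P w → DoubleNegation (InRatSpan e w)
  HasRank⇒InRatSpan {d} {r} P rank e e∈P e-indep w w∈P w∉span = proj₂ rank we we∈P we-indep
    where
    we : Fin (suc r) → V d
    we zero = w
    we (suc j) = e j
    we∈P : ∀ j → P (we j)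
    we∈P zero = w∈P
    we∈P (suc j) = e∈P j
    we-indep : LinIndep we
    we-indep a a·we≡0 = a≡0
      where
      lookup-a·we : ∀ p → a zero * lookup w p + lookup (lincomb (a ∘ suc) e) p ≡ + 0
      lookup-a·we p =
        trans (cong (_+ lookup (lincomb (a ∘ suc) e) p) (sym (lookup-·v (a zero) w p)))
              (trans (sym (lookup-+v (a zero ·v w) (lincomb (a ∘ suc) e) p))
                     (trans (cong (λ v → lookup v p) a·we≡0) (lookup-0v p)))
      a₀≡0 : a zero ≡ + 0
      a₀≡0 with a zero ℤ.≟ + 0
      ... | yes a₀≡0 = a₀≡0
      ... | no a₀≢0 = ⊥-elim (w∉span (ratSpan (a zero) a₀≢0 (λ j → - a (suc j)) (lookup-ext λ p →
            trans (lookup-·v (a zero) w p)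
            (trans (a+b≡0⇒a≡-b _ _ (lookup-a·we p))
            (trans (cong -_ (lookup-lincomb (a ∘ suc) e p))
            (trans (sym (sum-neg (λ j → a (suc j) * lookup (e j) p)))
            (trans (sum-cong-≗ {r} (λ j → ℤP.neg-distribˡ-* (a (suc j)) (lookup (e j) p)))
                   (sym (lookup-lincomb (λ j → - a (suc j)) e p)))))))))
      a₊·e≡0 : lincomb (a ∘ suc) e ≡ 0v
      a₊·e≡0 = lookup-ext λ p →
        trans (sym (ℤP.+-identityˡ _))
              (trans (cong (λ x → x * lookup w p + lookup (lincomb (a ∘ suc) e) p) (sym a₀≡0))
                     (trans (lookup-a·we p) (sym (lookup-0v p))))
      a≡0 : ∀ j → a j ≡ + 0
      a≡0 zero = a₀≡0
      a≡0 (suc j) = e-indep (a ∘ suc) a₊·e≡0 j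

  dependent-¬spans : ∀ {d} R (E fs : Fin R → V d) → LinIndep fs →
    (α : Fin R → ℤ) → lincomb α E ≡ 0v → (l : Fin R) → α l ≢ + 0 → ¬ (∀ k → InRatSpan E (fs k))
  dependent-¬spans (suc R) E fs fs-indep α α·E≡0 l αl≢0 fs∈span =
    steinitz R (E ∘ punchIn l) fs (λ k → InRatSpan-drop E α l α·E≡0 αl≢0 (fs∈span k)) fs-indep

  -- The Σ rᵢ independent elements of Y₁ + ⋯ + Y_t lie in the rational span of the combined bases,
  -- which therefore cannot satisfy a relation (dependent-¬spans).
  flatten-LinIndep : ∀ {d t} (Y : Fin t → Subgroup d) (r : Fin t → ℕ) → (∀ i → HasRank (Y i ∋_) (r i)) →
    HasRank (SumOf Y) (sumℕ r) →
    (e : (i : Fin t) → Fin (r i) → V d) → (∀ i j → Y i ∋ e i j) → (∀ i → LinIndep (e i)) →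
    LinIndep (flatten r e)
  flatten-LinIndep {d} {t} Y r rank-Y ((fs , fs∈ , fs-indep) , _) e e∈Y e-indep α α·E≡0 l with α l ℤ.≟ + 0
  ... | yes αl≡0 = αl≡0
  ... | no αl≢0 = ⊥-elim (¬¬-∀Fin fs∈span (dependent-¬spans (sumℕ r) (flatten r e) fs fs-indep α α·E≡0 l αl≢0))
    where
    fs∈span : ∀ k → DoubleNegation (InRatSpan (flatten r e) (fs k))
    fs∈span k with fs∈ k
    ... | v , v∈Y , v-sum =
      ¬¬-map (λ v∈span → subst (InRatSpan (flatten r e)) v-sum
                                (InRatSpan-sumV (flatten r e) v (λ i → InRatSpan-flatten r e i (v∈span i))))
             (¬¬-∀Fin (λ i → HasRank⇒InRatSpan (Y i ∋_) (rank-Y i) (e i) (e∈Y i) (e-indep i) (v i) (v∈Y i)))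

-- Finite lists, cardinalities and Minkowski sums

module _ where
  open import Data.Nat using (_+_; _*_; _≤_; _<_)

  private variable A B : Set

  Unique-⊆⇒length≤ : ∀ {L Z : List A} → Unique L → L ⊆ Z → length L ≤ length Z
  Unique-⊆⇒length≤ {L = []} _ _ = z≤n
  Unique-⊆⇒length≤ {L = x ∷ L} (x∉L ∷ L-unique) L⊆Z =
    ℕP.≤-trans (s≤s (Unique-⊆⇒length≤ L-unique (λ y∈L → ∈-delete (L⊆Z (there y∈L)) (x≢ y∈L) (L⊆Z (here refl)))))
               (ℕP.≤-reflexive (sym (length-delete (L⊆Z (here refl)))))
    where
    x≢ : ∀ {y} → y ∈ L → y ≢ x
    x≢ y∈L y≡x = All.lookup x∉L y∈L (sym y≡x)
    delete : ∀ {x : A} {Z : List A} → x ∈ Z → List A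
    delete {Z = _ ∷ Z} (here _) = Z
    delete {Z = z ∷ Z} (there p) = z ∷ delete p
    length-delete : ∀ {x : A} {Z : List A} (p : x ∈ Z) → length Z ≡ suc (length (delete p))
    length-delete (here _) = refl
    length-delete (there p) = cong suc (length-delete p)
    ∈-delete : ∀ {x y : A} {Z : List A} → y ∈ Z → y ≢ x → (p : x ∈ Z) → y ∈ delete p
    ∈-delete (here y≡z) y≢x (here x≡z) = ⊥-elim (y≢x (trans y≡z (sym x≡z)))
    ∈-delete (here y≡z) y≢x (there p) = here y≡z
    ∈-delete (there q) y≢x (here _) = q
    ∈-delete (there q) y≢x (there p) = there (∈-delete q y≢x p)

  Unique-map : ∀ (f : A → B) {L : List A} → (∀ {x y} → x ∈ L → y ∈ L → f x ≡ f y → x ≡ y) → Unique L → Unique (map f L)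
  Unique-map f {[]} _ _ = []
  Unique-map f {x ∷ L} f-inj (x∉L ∷ L-unique) =
    AllP.map⁺ (All.tabulate λ y∈L fx≡fy → All.lookup x∉L y∈L (f-inj (here refl) (there y∈L) fx≡fy))
      ∷ Unique-map f (λ x∈ y∈ → f-inj (there x∈) (there y∈)) L-unique

  card-⊆ : ∀ {m} {xs Z : List (V m)} → xs ⊆ Z → card xs ≤ length Z
  card-⊆ {xs = xs} xs⊆Z = Unique-⊆⇒length≤ (DecUniqueP.deduplicate-! _≟v_ xs) (xs⊆Z ∘ ∈P.∈-deduplicate⁻ _≟v_ xs)

  Unique-⊆⇒length≤card : ∀ {m} {L xs : List (V m)} → Unique L → L ⊆ xs → length L ≤ card xs
  Unique-⊆⇒length≤card L-unique L⊆xs = Unique-⊆⇒length≤ L-unique (∈P.∈-deduplicate⁺ _≟v_ ∘ L⊆xs)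

  card-map : ∀ {m k} (f : V m → V k) (xs : List (V m)) → card (map f xs) ≤ card xs
  card-map f xs = ℕP.≤-trans (card-⊆ fxs⊆) (ℕP.≤-reflexive (ListP.length-map f (deduplicate _≟v_ xs)))
    where
    fxs⊆ : map f xs ⊆ map f (deduplicate _≟v_ xs)
    fxs⊆ y∈ with ∈P.∈-map⁻ f y∈
    ... | x , x∈ , refl = ∈P.∈-map⁺ f (∈P.∈-deduplicate⁺ _≟v_ x∈)

  card≤length : ∀ {m} (xs : List (V m)) → card xs ≤ length xs
  card≤length xs = card-⊆ {xs = xs} (λ x∈ → x∈)

  ∈-concatMap-intro : ∀ (f : A → List B) {xs : List A} {x y} → x ∈ xs → y ∈ f x → y ∈ concatMap f xs
  ∈-concatMap-intro f x∈ y∈ = ∈P.∈-concatMap⁺ f (lose x∈ y∈)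

  ∈-concatMap-elim : ∀ (f : A → List B) (xs : List A) {y} → y ∈ concatMap f xs → ∃ λ x → x ∈ xs × y ∈ f x
  ∈-concatMap-elim f _ y∈ = find (∈P.∈-concatMap⁻ f y∈)

  length-concatMap : ∀ (f : A → List B) (xs : List A) (c : ℕ) → (∀ x → length (f x) ≡ c) → length (concatMap f xs) ≡ length xs * c
  length-concatMap f [] c _ = refl
  length-concatMap f (x ∷ xs) c ∣f∣≡c = trans (ListP.length-++ (f x)) (cong₂ _+_ (∣f∣≡c x) (length-concatMap f xs c ∣f∣≡c))

  Unique-concatMap : ∀ (f : A → List B) (xs : List A) → Unique xs → (∀ x → x ∈ xs → Unique (f x)) →
    (∀ {x x' y} → x ∈ xs → x' ∈ xs → y ∈ f x → y ∈ f x' → x ≡ x') → Unique (concatMap f xs)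
  Unique-concatMap f [] _ _ _ = []
  Unique-concatMap f (x ∷ xs) (x∉xs ∷ xs-unique) f-unique disjoint =
    UniqueP.++⁺ (f-unique x (here refl))
                (Unique-concatMap f xs xs-unique (λ y y∈ → f-unique y (there y∈)) (λ x∈ x'∈ → disjoint (there x∈) (there x'∈)))
                (λ (y∈fx , y∈rest) → let (x' , x'∈xs , y∈fx') = ∈-concatMap-elim f xs y∈rest
                                     in All.lookup x∉xs x'∈xs (disjoint (here refl) (there x'∈xs) y∈fx y∈fx'))

  prodℕ : ∀ {t} → (Fin t → ℕ) → ℕ
  prodℕ {zero} f = 1
  prodℕ {suc t} f = f zero * prodℕ (f ∘ suc)

  prodℕ-cong : ∀ {t} {f g : Fin t → ℕ} → (∀ i → f i ≡ g i) → prodℕ f ≡ prodℕ g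
  prodℕ-cong {zero} _ = refl
  prodℕ-cong {suc t} f≗g = cong₂ _*_ (f≗g zero) (prodℕ-cong (f≗g ∘ suc))

  prodℕ-↑ : ∀ m {n} (f : Fin (m + n) → ℕ) → prodℕ f ≡ prodℕ (λ i → f (i ↑ˡ n)) * prodℕ (λ j → f (m ↑ʳ j))
  prodℕ-↑ zero f = sym (ℕP.+-identityʳ _)
  prodℕ-↑ (suc m) f = trans (cong (f zero *_) (prodℕ-↑ m (f ∘ suc))) (sym (ℕP.*-assoc (f zero) _ _))

  prodℕ-const : ∀ n c → prodℕ {n} (λ _ → c) ≡ c ^ n
  prodℕ-const zero c = refl
  prodℕ-const (suc n) c = cong (c *_) (prodℕ-const n c)

  prodℕ-flatten : ∀ {t} (r : Fin t → ℕ) (K : Fin t → ℕ) → prodℕ (flatten r (λ i _ → K i)) ≡ prodℕ (λ i → K i ^ r i)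
  prodℕ-flatten {zero} r K = refl
  prodℕ-flatten {suc t} r K =
    trans (prodℕ-↑ (r zero) (flatten r (λ i _ → K i)))
          (cong₂ _*_ (trans (prodℕ-cong {r zero} (VectorP.lookup-++ˡ (λ _ → K zero) (flatten (r ∘ suc) (λ i _ → K (suc i))))) (prodℕ-const (r zero) (K zero)))
                     (trans (prodℕ-cong {sumℕ (r ∘ suc)} (VectorP.lookup-++ʳ (λ (_ : Fin (r zero)) → K zero) (flatten (r ∘ suc) (λ i _ → K (suc i))))) (prodℕ-flatten (r ∘ suc) (K ∘ suc))))

  prodℕ-mono : ∀ {t} {f g : Fin t → ℕ} → (∀ i → f i ≤ g i) → prodℕ f ≤ prodℕ g
  prodℕ-mono {zero} _ = ℕP.≤-refl
  prodℕ-mono {suc t} f≤g = ℕP.*-mono-≤ (f≤g zero) (prodℕ-mono (f≤g ∘ suc))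

  prodℕ-* : ∀ {t} (f g : Fin t → ℕ) → prodℕ (λ i → f i * g i) ≡ prodℕ f * prodℕ g
  prodℕ-* {zero} f g = refl
  prodℕ-* {suc t} f g = trans (cong (f zero * g zero *_) (prodℕ-* (f ∘ suc) (g ∘ suc))) (interchange (f zero) (g zero) _ _)
    where
    interchange : ∀ a b c d → a * b * (c * d) ≡ a * c * (b * d)
    interchange = ℕSolver.solve-∀

  prodℕ-pos : ∀ {t} (f : Fin t → ℕ) → (∀ i → 1 ≤ f i) → 1 ≤ prodℕ f
  prodℕ-pos {zero} f _ = ℕP.≤-refl
  prodℕ-pos {suc t} f 1≤f = ℕP.*-mono-≤ (1≤f zero) (prodℕ-pos (f ∘ suc) (1≤f ∘ suc))

  sumℕ-mono : ∀ {n} {f g : Fin n → ℕ} → (∀ i → f i ≤ g i) → sumℕ f ≤ sumℕ g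
  sumℕ-mono {zero} _ = z≤n
  sumℕ-mono {suc n} f≤g = ℕP.+-mono-≤ (f≤g zero) (sumℕ-mono (f≤g ∘ suc))

  sumℕ-* : ∀ {n} (K : ℕ) (f : Fin n → ℕ) → sumℕ (λ i → K * f i) ≡ K * sumℕ f
  sumℕ-* {zero} K f = sym (ℕP.*-zeroʳ K)
  sumℕ-* {suc n} K f = trans (cong (_+_ (K * f zero)) (sumℕ-* K (f ∘ suc))) (sym (ℕP.*-distribˡ-+ K (f zero) _))

  term≤sumℕ : ∀ {n} (f : Fin n → ℕ) l → f l ≤ sumℕ f
  term≤sumℕ {suc n} f zero = ℕP.m≤m+n (f zero) _
  term≤sumℕ {suc n} f (suc l) = ℕP.≤-trans (term≤sumℕ (f ∘ suc) l) (ℕP.m≤n+m _ (f zero))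

  ^-distrib-* : ∀ a b n → (a * b) ^ n ≡ a ^ n * b ^ n
  ^-distrib-* a b zero = refl
  ^-distrib-* a b (suc n) = trans (cong (a * b *_) (^-distrib-* a b n)) (interchange a b (a ^ n) (b ^ n))
    where
    interchange : ∀ a b x y → a * b * (x * y) ≡ a * x * (b * y)
    interchange = ℕSolver.solve-∀

  ∈-⊕⁺ : ∀ {d} {xs ys : List (V d)} {u v} → u ∈ xs → v ∈ ys → (u +v v) ∈ (xs ⊕ ys)
  ∈-⊕⁺ {ys = ys} {u} u∈ v∈ = ∈-concatMap-intro (λ u → map (u +v_) ys) u∈ (∈P.∈-map⁺ (u +v_) v∈)

  ∈-⊕⁻ : ∀ {d} (xs ys : List (V d)) {z} → z ∈ (xs ⊕ ys) → ∃ λ u → ∃ λ v → u ∈ xs × v ∈ ys × z ≡ u +v v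
  ∈-⊕⁻ xs ys z∈ with ∈-concatMap-elim (λ u → map (u +v_) ys) xs z∈
  ... | u , u∈ , z∈u+ys with ∈P.∈-map⁻ (u +v_) z∈u+ys
  ...   | v , v∈ , z≡u+v = u , v , u∈ , v∈ , z≡u+v

  length-⊕ : ∀ {d} (xs ys : List (V d)) → length (xs ⊕ ys) ≡ length xs * length ys
  length-⊕ xs ys = length-concatMap (λ u → map (u +v_) ys) xs (length ys) (λ u → ListP.length-map (u +v_) ys)

  ∈-⊕-all⁺ : ∀ {d t} (S : Fin t → List (V d)) (v : Fin t → V d) → (∀ i → v i ∈ S i) → sumV v ∈ ⊕-all S
  ∈-⊕-all⁺ {t = zero} S v _ = here refl
  ∈-⊕-all⁺ {t = suc t} S v v∈ = ∈-⊕⁺ (v∈ zero) (∈-⊕-all⁺ (S ∘ suc) (v ∘ suc) (v∈ ∘ suc))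

  ∈-⊕-all⁻ : ∀ {d t} (S : Fin t → List (V d)) {z} → z ∈ ⊕-all S → Σ (Fin t → V d) λ v → (∀ i → v i ∈ S i) × z ≡ sumV v
  ∈-⊕-all⁻ {t = zero} S (here refl) = (λ ()) , (λ ()) , refl
  ∈-⊕-all⁻ {t = suc t} S z∈ with ∈-⊕⁻ (S zero) (⊕-all (S ∘ suc)) z∈
  ... | u , w , u∈ , w∈ , z≡u+w with ∈-⊕-all⁻ (S ∘ suc) w∈
  ...   | v , v∈ , w≡Σv = (λ { zero → u ; (suc i) → v i }) , (λ { zero → u∈ ; (suc i) → v∈ i }) , trans z≡u+w (cong (u +v_) w≡Σv)

  length-⊕-all : ∀ {d t} (S : Fin t → List (V d)) → length (⊕-all S) ≡ prodℕ (λ i → length (S i))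
  length-⊕-all {t = zero} S = refl
  length-⊕-all {t = suc t} S = trans (length-⊕ (S zero) (⊕-all (S ∘ suc))) (cong (length (S zero) *_) (length-⊕-all (S ∘ suc)))

  length-boxes : ∀ r K → length (boxes r K) ≡ K ^ r
  length-boxes zero K = refl
  length-boxes (suc r) K =
    trans (length-concatMap _ (upTo K) (K ^ r) (λ a → trans (ListP.length-map _ (boxes r K)) (length-boxes r K)))
          (cong (_* (K ^ r)) (ListP.length-upTo K))

  ∈-boxes⁻ : ∀ r K {a} → a ∈ boxes r K → ∀ j → a j < K
  ∈-boxes⁻ (suc r) K a∈ j with ∈-concatMap-elim _ (upTo K) a∈
  ... | a₀ , a₀∈ , a∈a₀∷ with ∈P.∈-map⁻ _ a∈a₀∷
  ...   | rest , rest∈ , refl with j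
  ...     | zero = ∈P.∈-upTo⁻ a₀∈
  ...     | suc j' = ∈-boxes⁻ r K rest∈ j'

  ∈-boxes⁺ : ∀ r K (a : Fin r → ℕ) → (∀ j → a j < K) → ∃ λ a' → a' ∈ boxes r K × (∀ j → a' j ≡ a j)
  ∈-boxes⁺ zero K a _ = (λ ()) , here refl , (λ ())
  ∈-boxes⁺ (suc r) K a a<K with ∈-boxes⁺ r K (a ∘ suc) (a<K ∘ suc)
  ... | rest , rest∈ , rest≗ = _ , ∈-concatMap-intro _ (∈P.∈-upTo⁺ (a<K zero)) (∈P.∈-map⁺ _ rest∈) , (λ { zero → refl ; (suc j) → rest≗ j })

  ∈-S-Y⁻ : ∀ {d r} (e : Fin r → V d) K {s} → s ∈ S-Y e K → ∃ λ (a : Fin r → ℕ) → (∀ j → a j < K) × s ≡ lincomb (λ j → + a j) e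
  ∈-S-Y⁻ {r = r} e K s∈ with ∈P.∈-map⁻ (λ a → lincomb (λ j → + a j) e) s∈
  ... | a , a∈ , s≡ = a , ∈-boxes⁻ r K a∈ , s≡

  ∈-S-Y⁺ : ∀ {d r} (e : Fin r → V d) K (a : Fin r → ℕ) → (∀ j → a j < K) → lincomb (λ j → + a j) e ∈ S-Y e K
  ∈-S-Y⁺ {r = r} e K a a<K with ∈-boxes⁺ r K a a<K
  ... | a' , a'∈ , a'≗a = subst (_∈ S-Y e K) (lincomb-cong (λ j → cong +_ (a'≗a j)) (λ _ → refl))
                                 (∈P.∈-map⁺ (λ a → lincomb (λ j → + a j) e) a'∈)

  length-S-Y : ∀ {d r} (e : Fin r → V d) K → length (S-Y e K) ≡ K ^ r
  length-S-Y {r = r} e K = trans (ListP.length-map _ (boxes r K)) (length-boxes r K)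

  grid : ∀ {n} → (Fin n → List A) → List (Vec A n)
  grid {n = zero} L = [] ∷ []
  grid {n = suc n} L = concatMap (λ a → map (a ∷_) (grid (L ∘ suc))) (L zero)

  ∈-grid⁺ : ∀ {n} (L : Fin n → List A) (v : Vec A n) → (∀ p → lookup v p ∈ L p) → v ∈ grid L
  ∈-grid⁺ {n = zero} L [] _ = here refl
  ∈-grid⁺ {n = suc n} L (x ∷ v) v∈ =
    ∈-concatMap-intro (λ a → map (a ∷_) (grid (L ∘ suc))) (v∈ zero) (∈P.∈-map⁺ (x ∷_) (∈-grid⁺ (L ∘ suc) v (v∈ ∘ suc)))

  ∈-grid⁻ : ∀ {n} (L : Fin n → List A) (v : Vec A n) → v ∈ grid L → ∀ p → lookup v p ∈ L p
  ∈-grid⁻ {n = suc n} L v v∈ p with ∈-concatMap-elim (λ a → map (a ∷_) (grid (L ∘ suc))) (L zero) v∈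
  ... | a , a∈ , v∈a∷ with ∈P.∈-map⁻ (a ∷_) v∈a∷
  ...   | w , w∈ , refl with p
  ...     | zero = a∈
  ...     | suc p' = ∈-grid⁻ (L ∘ suc) w w∈ p'

  length-grid : ∀ {n} (L : Fin n → List A) → length (grid L) ≡ prodℕ (λ p → length (L p))
  length-grid {n = zero} L = refl
  length-grid {n = suc n} L = length-concatMap _ (L zero) _ (λ a → trans (ListP.length-map (a ∷_) (grid (L ∘ suc))) (length-grid (L ∘ suc)))

  Unique-grid : ∀ {n} (L : Fin n → List A) → (∀ p → Unique (L p)) → Unique (grid L)
  Unique-grid {n = zero} L _ = All.[] ∷ []
  Unique-grid {n = suc n} L L-unique =
    Unique-concatMap _ (L zero) (L-unique zero)
      (λ a _ → Unique-map (a ∷_) (λ _ _ → VecP.∷-injectiveʳ) (Unique-grid (L ∘ suc) (L-unique ∘ suc)))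
      (λ {a} {a'} _ _ → same-head a a')
    where
    same-head : ∀ a a' {y} → y ∈ map (a ∷_) (grid (L ∘ suc)) → y ∈ map (a' ∷_) (grid (L ∘ suc)) → a ≡ a'
    same-head a a' y∈ y∈' with ∈P.∈-map⁻ (a ∷_) y∈ | ∈P.∈-map⁻ (a' ∷_) y∈'
    ... | _ , _ , y≡ | _ , _ , y≡' = VecP.∷-injectiveˡ (trans (sym y≡) y≡')

-- Parallelepipeds tile the lattice

module _ where
  open import Data.Integer using (_+_; _*_; -_)
  open ℤSolver using (solve-∀)

  ρ+k*d≡ρ'⇒k≡0 : ∀ ρ ρ' d k → ρ ℕ.< d → ρ' ℕ.< d → + ρ + k * + d ≡ + ρ' → k ≡ + 0
  ρ+k*d≡ρ'⇒k≡0 ρ ρ' d (+ zero) _ _ _ = refl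
  ρ+k*d≡ρ'⇒k≡0 ρ ρ' d +[1+ n ] ρ<d ρ'<d eq = ⊥-elim (ℕP.<⇒≱ ρ'<d d≤ρ')
    where
    d≤ρ' : d ℕ.≤ ρ'
    d≤ρ' = ℕP.≤-trans (ℕP.m≤m+n d (n ℕ.* d)) (ℕP.≤-trans (ℕP.m≤n+m (suc n ℕ.* d) ρ)
             (ℕP.≤-reflexive (ℤP.+-injective (trans (ℤP.pos-+ ρ (suc n ℕ.* d)) (trans (cong (_+_ (+ ρ)) (ℤP.pos-* (suc n) d)) eq)))))
  ρ+k*d≡ρ'⇒k≡0 ρ ρ' d -[1+ n ] ρ<d ρ'<d eq = ⊥-elim (ℕP.<⇒≱ ρ<d d≤ρ)
    where
    move : ∀ a b k D → a + - k * D ≡ b → b + k * D ≡ a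
    move a b k D a-kD≡b = trans (cong (_+ k * D) (sym a-kD≡b)) (cancel a k D)
      where
      cancel : ∀ a k D → a + - k * D + k * D ≡ a
      cancel = solve-∀
    d≤ρ : d ℕ.≤ ρ
    d≤ρ = ℕP.≤-trans (ℕP.m≤m+n d (n ℕ.* d)) (ℕP.≤-trans (ℕP.m≤n+m (suc n ℕ.* d) ρ')
            (ℕP.≤-reflexive (ℤP.+-injective (trans (ℤP.pos-+ ρ' (suc n ℕ.* d))
              (trans (cong (_+_ (+ ρ')) (ℤP.pos-* (suc n) d)) (move (+ ρ) (+ ρ') +[1+ n ] (+ d) eq))))))

  divMod-unique : ∀ (n : ℤ) (d : ℕ) .{{_ : NonZero d}} (ρ : ℕ) (q : ℤ) → ρ ℕ.< d → n ≡ + ρ + q * + d →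
    (n %ℕ d ≡ ρ) × (n /ℕ d ≡ q)
  divMod-unique n d ρ q ρ<d n≡ρ+qd = ρ₀≡ρ , q₀≡q
    where
    ρ₀ : ℕ
    ρ₀ = n %ℕ d
    q₀ : ℤ
    q₀ = n /ℕ d
    ρ₀+q₀d≡ρ+qd : + ρ₀ + q₀ * + d ≡ + ρ + q * + d
    ρ₀+q₀d≡ρ+qd = trans (sym (a≡a%ℕn+[a/ℕn]*n n d)) n≡ρ+qd
    shift : ∀ a b x y D → a + x * D ≡ b + y * D → a + (x + - y) * D ≡ b
    shift a b x y D eq = trans (distrib a x y D) (trans (cong (_+ - (y * D)) eq) (cancel b y D))
      where
      distrib : ∀ a x y D → a + (x + - y) * D ≡ a + x * D + - (y * D)
      distrib = solve-∀
      cancel : ∀ b y D → b + y * D + - (y * D) ≡ b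
      cancel = solve-∀
    q₀-q≡0 : q₀ + - q ≡ + 0
    q₀-q≡0 = ρ+k*d≡ρ'⇒k≡0 ρ₀ ρ d (q₀ + - q) (n%ℕd<d n d) ρ<d (shift (+ ρ₀) (+ ρ) q₀ q (+ d) ρ₀+q₀d≡ρ+qd)
    q₀≡q : q₀ ≡ q
    q₀≡q = trans (sym (cancel q₀ q)) (trans (cong (_+ q) q₀-q≡0) (ℤP.+-identityˡ q))
      where
      cancel : ∀ a b → a + - b + b ≡ a
      cancel = solve-∀
    ρ₀≡ρ : ρ₀ ≡ ρ
    ρ₀≡ρ = ℤP.+-injective (cancelʳ (+ ρ₀) (+ ρ) (q * + d) (trans (cong (λ z → + ρ₀ + z * + d) (sym q₀≡q)) ρ₀+q₀d≡ρ+qd))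
      where
      cancel : ∀ a c → a + c + - c ≡ a
      cancel = solve-∀
      cancelʳ : ∀ a b c → a + c ≡ b + c → a ≡ b
      cancelʳ a b c a+c≡b+c = trans (sym (cancel a c)) (trans (cong (_+ - c) a+c≡b+c) (cancel b c))

  parallelepiped : ∀ {d t} (r : Fin t → ℕ) (e : (i : Fin t) → Fin (r i) → V d) (K : Fin t → ℕ) → List (V d)
  parallelepiped r e K = ⊕-all (λ i → S-Y (e i) (K i))

  module Parallelepiped {d t} (r : Fin t → ℕ) (e : (i : Fin t) → Fin (r i) → V d) (K : Fin t → ℕ) where
    E : Fin (sumℕ r) → V d
    E = flatten r e
    side : Fin (sumℕ r) → ℕ
    side = flatten r (λ i _ → K i)

    ∈-parallelepiped⁻ : ∀ {s} → s ∈ parallelepiped r e K →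
      Σ (Fin (sumℕ r) → ℕ) λ a → (∀ l → a l ℕ.< side l) × s ≡ lincomb (λ l → + a l) E
    ∈-parallelepiped⁻ s∈ with ∈-⊕-all⁻ (λ i → S-Y (e i) (K i)) s∈
    ... | v , v∈ , s≡Σv = flatten r a , a<side , (begin
        _                                                   ≡⟨ s≡Σv ⟩
        sumV v                                              ≡⟨ sumV-cong (λ i → proj₂ (proj₂ (∈-S-Y⁻ (e i) (K i) (v∈ i)))) ⟩
        sumV (λ i → lincomb (λ j → + a i j) (e i))          ≡⟨ sym (lincomb-flatten r (λ i j → + a i j) e) ⟩
        lincomb (flatten r (λ i j → + a i j)) E             ≡⟨ lincomb-cong (flatten-map r a (λ n → + n)) (λ _ → refl) ⟩
        lincomb (λ l → + flatten r a l) E                   ∎)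
      where
      open ≡-Reasoning
      a : (i : Fin t) → Fin (r i) → ℕ
      a i = proj₁ (∈-S-Y⁻ (e i) (K i) (v∈ i))
      a<side : ∀ l → flatten r a l ℕ.< side l
      a<side l with flatIndex-surjective r l
      ... | i , j , refl = subst₂ ℕ._<_ (sym (flatten-flatIndex r a i j)) (sym (flatten-flatIndex r (λ i _ → K i) i j))
                                  (proj₁ (proj₂ (∈-S-Y⁻ (e i) (K i) (v∈ i))) j)

    ∈-parallelepiped⁺ : (a : Fin (sumℕ r) → ℕ) → (∀ l → a l ℕ.< side l) → lincomb (λ l → + a l) E ∈ parallelepiped r e K
    ∈-parallelepiped⁺ a a<side =
      subst (_∈ parallelepiped r e K) Σ≡
            (∈-⊕-all⁺ (λ i → S-Y (e i) (K i)) (λ i → lincomb (λ j → + aᵢ i j) (e i))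
                      (λ i → ∈-S-Y⁺ (e i) (K i) (aᵢ i) (λ j → subst (a (flatIndex r i j) ℕ.<_) (flatten-flatIndex r (λ i _ → K i) i j) (a<side (flatIndex r i j)))))
      where
      aᵢ : (i : Fin t) → Fin (r i) → ℕ
      aᵢ i j = a (flatIndex r i j)
      Σ≡ : sumV (λ i → lincomb (λ j → + aᵢ i j) (e i)) ≡ lincomb (λ l → + a l) E
      Σ≡ = trans (sym (lincomb-flatten r (λ i j → + aᵢ i j) e))
                 (lincomb-cong (λ l → trans (flatten-map r aᵢ (λ n → + n) l) (cong +_ (flatten-flatIndex⁻¹ r a l))) (λ _ → refl))

    length-parallelepiped : length (parallelepiped r e K) ≡ prodℕ (λ i → K i ^ r i)
    length-parallelepiped = trans (length-⊕-all (λ i → S-Y (e i) (K i))) (prodℕ-cong (λ i → length-S-Y (e i) (K i)))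

  +v-cancelʳ : ∀ {d} {u v w : V d} → u +v w ≡ v +v w → u ≡ v
  +v-cancelʳ {u = u} {v} {w} u+w≡v+w = lookup-ext λ p →
    trans (sym (cancel (lookup u p) (lookup w p)))
          (trans (cong (_+ - lookup w p) (trans (sym (lookup-+v u w p)) (trans (cong (λ z → lookup z p) u+w≡v+w) (lookup-+v v w p))))
                 (cancel (lookup v p) (lookup w p)))
    where
    cancel : ∀ a b → a + b + - b ≡ a
    cancel = solve-∀

  -- With the dual basis Λ of E (factor D), the digits ⌊Λₗ·x / D⌋ mod side l are the coordinates of x
  -- in the parallelepiped; the translations are the points all of whose digits vanish.
  parallelepiped-tiles : ∀ {d t} (r : Fin t → ℕ) (e : (i : Fin t) → Fin (r i) → V d) (K : Fin t → ℕ) →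
    (∀ i → K i ≢ 0) → LinIndep (flatten r e) → Tiles (parallelepiped r e K)
  parallelepiped-tiles {d} r e K K≢0 indep = IsTranslation , cover , disjoint
    where
    open Parallelepiped r e K
    open DualBasis (dualBasis (sumℕ r) E indep)
    instance
      D-nonZero : NonZero D
      D-nonZero = ℕ.≢-nonZero D≢0
    side-nonZero : ∀ l → NonZero (side l)
    side-nonZero l with flatIndex-surjective r l
    ... | i , j , refl = ℕ.≢-nonZero (subst (_≢ 0) (sym (flatten-flatIndex r (λ i _ → K i) i j)) (K≢0 i))

    quotient : Fin (sumℕ r) → V d → ℤ
    quotient l x = dot (Λ l) x /ℕ D
    digit : Fin (sumℕ r) → V d → ℕ
    digit l x = (quotient l x %ℕ side l) {{side-nonZero l}}
    digit<side : ∀ x l → digit l x ℕ.< side l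
    digit<side x l = n%ℕd<d (quotient l x) (side l) {{side-nonZero l}}
    carry : Fin (sumℕ r) → V d → ℤ
    carry l x = (quotient l x /ℕ side l) {{side-nonZero l}}
    IsTranslation : V d → Set
    IsTranslation x = ∀ l → digit l x ≡ 0
    offset : V d → V d
    offset x = lincomb (λ l → + digit l x) E

    quotient-shift : ∀ l x y k → dot (Λ l) y ≡ dot (Λ l) x + k * + D → quotient l y ≡ quotient l x + k
    quotient-shift l x y k Λy≡Λx+kD =
      proj₂ (divMod-unique (dot (Λ l) y) D (dot (Λ l) x %ℕ D) (quotient l x + k) (n%ℕd<d (dot (Λ l) x) D)
              (trans Λy≡Λx+kD (trans (cong (_+ k * + D) (a≡a%ℕn+[a/ℕn]*n (dot (Λ l) x) D)) (regroup (+ (dot (Λ l) x %ℕ D)) (quotient l x) k (+ D)))))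
      where
      regroup : ∀ ρ q k D → ρ + q * D + k * D ≡ ρ + (q + k) * D
      regroup = solve-∀
    quotient≡digit+carry : ∀ l x → quotient l x ≡ + digit l x + carry l x * + side l
    quotient≡digit+carry l x = a≡a%ℕn+[a/ℕn]*n (quotient l x) (side l) {{side-nonZero l}}
    digit-unique : ∀ l y a h → a ℕ.< side l → quotient l y ≡ + a + h * + side l → digit l y ≡ a
    digit-unique l y a h a<side eq = proj₁ (divMod-unique (quotient l y) (side l) {{side-nonZero l}} a h a<side eq)

    digit-translate : ∀ {x} (b : Fin (sumℕ r) → ℕ) → IsTranslation x → (∀ l → b l ℕ.< side l) →
      ∀ l → digit l (x +v lincomb (λ m → + b m) E) ≡ b l
    digit-translate {x} b x∈T b<side l = digit-unique l (x +v lincomb (λ m → + b m) E) (b l) (carry l x) (b<side l) (begin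
      quotient l (x +v lincomb (λ m → + b m) E)   ≡⟨ quotient-shift l x (x +v lincomb (λ m → + b m) E) (+ b l) Λ-shift ⟩
      quotient l x + + b l                        ≡⟨ cong (_+ + b l) (quotient≡digit+carry l x) ⟩
      + digit l x + carry l x * + side l + + b l  ≡⟨ cong (λ c → + c + carry l x * + side l + + b l) (x∈T l) ⟩
      + 0 + carry l x * + side l + + b l          ≡⟨ swap (carry l x * + side l) (+ b l) ⟩
      + b l + carry l x * + side l                ∎)
      where
      open ≡-Reasoning
      swap : ∀ a b → + 0 + a + b ≡ b + a
      swap = solve-∀
      Λ-shift : dot (Λ l) (x +v lincomb (λ m → + b m) E) ≡ dot (Λ l) x + + b l * + D
      Λ-shift = trans (dot-+ʳ (Λ l) x _) (cong (_+_ (dot (Λ l) x)) (dot-Λ-lincomb (λ m → + b m) l))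

    IsTranslation-minus-offset : ∀ x → IsTranslation (x +v (-v offset x))
    IsTranslation-minus-offset x l = digit-unique l (x +v (-v offset x)) 0 (carry l x) (ℕ.>-nonZero⁻¹ (side l) {{side-nonZero l}}) (begin
      quotient l (x +v (-v offset x))              ≡⟨ quotient-shift l x (x +v (-v offset x)) (- + digit l x) Λ-shift ⟩
      quotient l x + - + digit l x                 ≡⟨ cong (_+ - + digit l x) (quotient≡digit+carry l x) ⟩
      + digit l x + carry l x * + side l + - + digit l x ≡⟨ cancel (+ digit l x) (carry l x * + side l) ⟩
      + 0 + carry l x * + side l                   ∎)
      where
      open ≡-Reasoning
      cancel : ∀ c a → c + a + - c ≡ + 0 + a
      cancel = solve-∀
      Λ-shift : dot (Λ l) (x +v (-v offset x)) ≡ dot (Λ l) x + - + digit l x * + D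
      Λ-shift = trans (dot-+ʳ (Λ l) x (-v offset x))
                      (cong (_+_ (dot (Λ l) x)) (trans (dot--ʳ (Λ l) (offset x))
                                                       (trans (cong -_ (dot-Λ-lincomb (λ m → + digit m x) l))
                                                              (ℤP.neg-distribˡ-* (+ digit l x) (+ D)))))

    cover : (x : V d) → Σ (V d) λ t → Σ (V d) λ s → IsTranslation t × (s ∈ parallelepiped r e K) × (t +v s ≡ x)
    cover x = x +v (-v offset x) , offset x , IsTranslation-minus-offset x ,
              ∈-parallelepiped⁺ (λ l → digit l x) (digit<side x) , +v--v x (offset x)

    disjoint : ∀ {t t' s s'} → IsTranslation t → IsTranslation t' → s ∈ parallelepiped r e K → s' ∈ parallelepiped r e K →
      t +v s ≡ t' +v s' → t ≡ t'
    disjoint {t} {t'} {s} {s'} t∈T t'∈T s∈ s'∈ t+s≡t'+s' with ∈-parallelepiped⁻ s∈ | ∈-parallelepiped⁻ s'∈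
    ... | a , a<side , refl | a' , a'<side , refl = +v-cancelʳ (trans t+s≡t'+s' (cong (t' +v_) (sym s≡s')))
      where
      a≡a' : ∀ l → a l ≡ a' l
      a≡a' l = trans (sym (digit-translate {t} a t∈T a<side l))
                     (trans (cong (digit l) t+s≡t'+s') (digit-translate {t'} a' t'∈T a'<side l))
      s≡s' : lincomb (λ l → + a l) E ≡ lincomb (λ l → + a' l) E
      s≡s' = lincomb-cong (λ l → cong +_ (a≡a' l)) (λ _ → refl)

  -- The coordinates x ↦ (Λₗ·x)ₗ take the values (D aₗ)ₗ, for all a in the box, on the parallelepiped.
  card-parallelepiped-≥ : ∀ {d t} (r : Fin t → ℕ) (e : (i : Fin t) → Fin (r i) → V d) (K : Fin t → ℕ) →
    LinIndep (flatten r e) → prodℕ (λ i → K i ^ r i) ℕ.≤ card (parallelepiped r e K)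
  card-parallelepiped-≥ {d} r e K indep = begin
    prodℕ (λ i → K i ^ r i)                  ≡⟨ sym (trans (length-grid multiples) (trans (prodℕ-cong length-multiples) (prodℕ-flatten r K))) ⟩
    length (grid multiples)                  ≤⟨ Unique-⊆⇒length≤card (Unique-grid multiples multiples-unique) grid⊆ ⟩
    card (map Φ (parallelepiped r e K))      ≤⟨ card-map Φ (parallelepiped r e K) ⟩
    card (parallelepiped r e K)              ∎
    where
    open ℕP.≤-Reasoning
    open Parallelepiped r e K
    open DualBasis (dualBasis (sumℕ r) E indep)
    Φ : V d → V (sumℕ r)
    Φ x = Vec.tabulate (λ l → dot (Λ l) x)
    multiples : Fin (sumℕ r) → List ℤ
    multiples l = map (λ a → + a * + D) (upTo (side l))
    length-multiples : ∀ l → length (multiples l) ≡ side l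
    length-multiples l = trans (ListP.length-map _ (upTo (side l))) (ListP.length-upTo _)
    multiples-unique : ∀ l → Unique (multiples l)
    multiples-unique l = Unique-map (λ a → + a * + D)
      (λ _ _ aD≡bD → ℤP.+-injective (ℤP.*-cancelʳ-≡ (+ _) (+ _) (+ D) {{ℤ.≢-nonZero (D≢0 ∘ ℤP.+-injective)}} aD≡bD))
      (UniqueP.upTo⁺ _)
    grid⊆ : grid multiples ⊆ map Φ (parallelepiped r e K)
    grid⊆ {v} v∈ = subst (_∈ map Φ (parallelepiped r e K)) Φs≡v (∈P.∈-map⁺ Φ (∈-parallelepiped⁺ a a<side))
      where
      vₗ∈ : ∀ l → ∃ λ a → a ∈ upTo (side l) × lookup v l ≡ + a * + D
      vₗ∈ l = ∈P.∈-map⁻ (λ a → + a * + D) (∈-grid⁻ multiples v v∈ l)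
      a : Fin (sumℕ r) → ℕ
      a l = proj₁ (vₗ∈ l)
      a<side : ∀ l → a l ℕ.< side l
      a<side l = ∈P.∈-upTo⁻ (proj₁ (proj₂ (vₗ∈ l)))
      Φs≡v : Φ (lincomb (λ l → + a l) E) ≡ v
      Φs≡v = lookup-ext λ l → trans (VecP.lookup∘tabulate _ l) (trans (dot-Λ-lincomb (λ m → + a m) l) (sym (proj₂ (proj₂ (vₗ∈ l)))))

-- Images of parallelepipeds under homomorphisms

  module Homomorphism {d m} (φ : V d → V m) (hom : IsHom φ) where

    hom-0v : φ 0v ≡ 0v
    hom-0v = lookup-ext λ p →
      trans (a≡a+a⇒a≡0 (lookup (φ 0v) p)
                       (trans (cong (λ v → lookup v p) (trans (cong φ (sym 0+0)) (hom 0v 0v))) (lookup-+v (φ 0v) (φ 0v) p)))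
            (sym (lookup-0v p))
      where
      0+0 : 0v +v 0v ≡ 0v {d}
      0+0 = lookup-ext λ p → trans (lookup-+v 0v 0v p) (trans (cong₂ _+_ (lookup-0v p) (lookup-0v p)) (sym (lookup-0v p)))
      a≡a+a⇒a≡0 : ∀ a → a ≡ a + a → a ≡ + 0
      a≡a+a⇒a≡0 a a≡a+a = trans (sym (cancel a)) (trans (cong (_+ - a) (sym a≡a+a)) (ℤP.+-inverseʳ a))
        where
        cancel : ∀ a → a + a + - a ≡ a
        cancel = solve-∀

    hom--v : ∀ u → φ (-v u) ≡ -v φ u
    hom--v u = lookup-ext λ p →
      trans (a+b≡0⇒a≡-b _ _ (trans (sym (lookup-+v (φ (-v u)) (φ u) p))
                                   (trans (cong (λ v → lookup v p) (trans (sym (hom (-v u) u)) (trans (cong φ -u+u≡0) hom-0v))) (lookup-0v p))))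
            (sym (lookup--v (φ u) p))
      where
      -u+u≡0 : (-v u) +v u ≡ 0v
      -u+u≡0 = lookup-ext λ p → trans (lookup-+v (-v u) u p) (trans (cong (_+ lookup u p) (lookup--v u p)) (trans (ℤP.+-inverseˡ (lookup u p)) (sym (lookup-0v p))))

    hom-·v : ∀ a u → φ (a ·v u) ≡ a ·v φ u
    hom-·v (+ n) u = hom-·ℕ n
      where
      0·v : ∀ {k} (w : V k) → (+ 0) ·v w ≡ 0v
      0·v w = lookup-ext λ p → trans (lookup-·v (+ 0) w p) (sym (lookup-0v p))
      suc·v : ∀ {k} n (w : V k) → (+ suc n) ·v w ≡ w +v ((+ n) ·v w)
      suc·v n w = lookup-ext λ p →
        trans (lookup-·v (+ suc n) w p)
              (trans (trans (cong (_* lookup w p) (sym (ℤP.pos-+ 1 n))) (trans (ℤP.*-distribʳ-+ (lookup w p) (+ 1) (+ n)) (cong (_+ + n * lookup w p) (ℤP.*-identityˡ (lookup w p)))))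
                     (sym (trans (lookup-+v w ((+ n) ·v w) p) (cong (_+_ (lookup w p)) (lookup-·v (+ n) w p)))))
      hom-·ℕ : ∀ n → φ ((+ n) ·v u) ≡ (+ n) ·v φ u
      hom-·ℕ zero = trans (cong φ (0·v u)) (trans hom-0v (sym (0·v (φ u))))
      hom-·ℕ (suc n) = trans (cong φ (suc·v n u)) (trans (hom u ((+ n) ·v u)) (trans (cong (φ u +v_) (hom-·ℕ n)) (sym (suc·v n (φ u)))))
    hom-·v -[1+ n ] u = trans (cong φ (neg·v u)) (trans (hom--v ((+ suc n) ·v u)) (trans (cong -v_ (hom-·v (+ suc n) u)) (sym (neg·v (φ u)))))
      where
      neg·v : ∀ {k} (w : V k) → -[1+ n ] ·v w ≡ -v ((+ suc n) ·v w)
      neg·v w = lookup-ext λ p →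
        trans (lookup-·v -[1+ n ] w p)
              (trans (sym (ℤP.neg-distribˡ-* (+ suc n) (lookup w p))) (sym (trans (lookup--v ((+ suc n) ·v w) p) (cong -_ (lookup-·v (+ suc n) w p)))))

    hom-lincomb : ∀ {r} (b : Fin r → ℤ) (e : Fin r → V d) → φ (lincomb b e) ≡ lincomb b (φ ∘ e)
    hom-lincomb {zero} b e = hom-0v
    hom-lincomb {suc r} b e = trans (hom (b zero ·v e zero) (lincomb (b ∘ suc) (e ∘ suc))) (cong₂ _+v_ (hom-·v (b zero) (e zero)) (hom-lincomb (b ∘ suc) (e ∘ suc)))

    card-map-⊕ : ∀ (xs ys : List (V d)) → card (map φ (xs ⊕ ys)) ℕ.≤ card (map φ xs) ℕ.* card (map φ ys)
    card-map-⊕ xs ys = ℕP.≤-trans (card-⊆ ⊆⊕) (ℕP.≤-reflexive (length-⊕ (deduplicate _≟v_ (map φ xs)) (deduplicate _≟v_ (map φ ys))))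
      where
      ⊆⊕ : map φ (xs ⊕ ys) ⊆ (deduplicate _≟v_ (map φ xs) ⊕ deduplicate _≟v_ (map φ ys))
      ⊆⊕ w∈ with ∈P.∈-map⁻ φ w∈
      ... | z , z∈ , refl with ∈-⊕⁻ xs ys z∈
      ...   | u , v , u∈ , v∈ , refl =
        subst (_∈ _) (sym (hom u v)) (∈-⊕⁺ (∈P.∈-deduplicate⁺ _≟v_ (∈P.∈-map⁺ φ u∈)) (∈P.∈-deduplicate⁺ _≟v_ (∈P.∈-map⁺ φ v∈)))

    card-map-⊕-all : ∀ {t} (S : Fin t → List (V d)) → card (map φ (⊕-all S)) ℕ.≤ prodℕ (λ i → card (map φ (S i)))
    card-map-⊕-all {zero} S = card≤length (φ 0v ∷ [])
    card-map-⊕-all {suc t} S = ℕP.≤-trans (card-map-⊕ (S zero) (⊕-all (S ∘ suc))) (ℕP.*-monoʳ-≤ (card (map φ (S zero))) (card-map-⊕-all (S ∘ suc)))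

  dual-coordinates-injective : ∀ {d R} {h : Fin R → V d} (dual : DualBasis h) {x y} →
    InRatSpan h x → InRatSpan h y → (∀ l → dot (DualBasis.Λ dual l) x ≡ dot (DualBasis.Λ dual l) y) → x ≡ y
  dual-coordinates-injective {h = h} dual {x} {y} x∈ y∈ Λx≡Λy = trans (sym (+v--v x y)) (trans (cong (_+v y) x-y≡0) 0+y≡y)
    where
    open DualBasis dual
    x-y∈ : InRatSpan h (x +v (-v y))
    x-y∈ = InRatSpan-+ h x∈ (subst (InRatSpan h) (-1·v y) (InRatSpan-· h -[1+ 0 ] y∈))
      where
      -1·v : ∀ {k} (w : V k) → -[1+ 0 ] ·v w ≡ -v w
      -1·v w = lookup-ext λ p → trans (lookup-·v -[1+ 0 ] w p) (trans (ℤP.-1*i≡-i (lookup w p)) (sym (lookup--v w p)))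
    open InRatSpan x-y∈
    coeffs≡0 : ∀ l → coeffs l ≡ + 0
    coeffs≡0 l = i*j≡0⇒j≡0 (D≢0 ∘ ℤP.+-injective) (begin
      + D * coeffs l                   ≡⟨ ℤP.*-comm (+ D) (coeffs l) ⟩
      coeffs l * + D                   ≡⟨ sym (dot-Λ-lincomb coeffs l) ⟩
      dot (Λ l) (lincomb coeffs h)     ≡⟨ cong (dot (Λ l)) (sym scaled) ⟩
      dot (Λ l) (scale ·v (x +v (-v y))) ≡⟨ dot-·ʳ (Λ l) scale (x +v (-v y)) ⟩
      scale * dot (Λ l) (x +v (-v y))  ≡⟨ cong (scale *_) (trans (dot-+ʳ (Λ l) x (-v y)) (cong₂ _+_ (Λx≡Λy l) (dot--ʳ (Λ l) y))) ⟩
      scale * (dot (Λ l) y + - dot (Λ l) y) ≡⟨ cong (scale *_) (ℤP.+-inverseʳ (dot (Λ l) y)) ⟩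
      scale * + 0                      ≡⟨ ℤP.*-zeroʳ scale ⟩
      + 0                              ∎)
      where open ≡-Reasoning
    x-y≡0 : x +v (-v y) ≡ 0v
    x-y≡0 = lookup-ext λ p → trans (i*j≡0⇒j≡0 scale≢0
      (trans (sym (lookup-·v scale (x +v (-v y)) p)) (trans (cong (λ v → lookup v p) (trans scaled (trans (lincomb-cong coeffs≡0 (λ _ → refl)) (lincomb-zero h)))) (lookup-0v p))))
      (sym (lookup-0v p))
    0+y≡y : 0v +v y ≡ y
    0+y≡y = lookup-ext λ p → trans (lookup-+v 0v y p) (trans (cong (_+ lookup y p) (lookup-0v p)) (ℤP.+-identityˡ (lookup y p)))

  ∣sum∣≤sumℕ∣∣ : ∀ {n} (f : Fin n → ℤ) → ℤ.∣ sum f ∣ ℕ.≤ sumℕ (λ i → ℤ.∣ f i ∣)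
  ∣sum∣≤sumℕ∣∣ {zero} f = z≤n
  ∣sum∣≤sumℕ∣∣ {suc n} f =
    ℕP.≤-trans (ℤP.∣i+j∣≤∣i∣+∣j∣ (f zero) (sum (f ∘ suc))) (ℕP.+-monoʳ-≤ ℤ.∣ f zero ∣ (∣sum∣≤sumℕ∣∣ (f ∘ suc)))

  range : ℕ → List ℤ
  range N = map +_ (upTo (suc N)) ++ map -[1+_] (upTo N)

  ∈-range : ∀ N z → ℤ.∣ z ∣ ℕ.≤ N → z ∈ range N
  ∈-range N (+ n) ∣z∣≤N = ∈P.∈-++⁺ˡ (∈P.∈-map⁺ +_ (∈P.∈-upTo⁺ (s≤s ∣z∣≤N)))
  ∈-range N -[1+ n ] ∣z∣≤N = ∈P.∈-++⁺ʳ (map +_ (upTo (suc N))) (∈P.∈-map⁺ -[1+_] (∈P.∈-upTo⁺ ∣z∣≤N))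

  length-range : ∀ N → length (range N) ≡ suc N ℕ.+ N
  length-range N =
    trans (ListP.length-++ (map +_ (upTo (suc N))))
          (cong₂ ℕ._+_ (trans (ListP.length-map +_ (upTo (suc N))) (ListP.length-upTo (suc N)))
                       (trans (ListP.length-map -[1+_] (upTo N)) (ListP.length-upTo N)))

  -- φ(S_Y) lies in the rank-ρ group φ(Y); in dual coordinates of a maximal independent family of φ(Y)
  -- its points are distinct and bounded by a multiple of the side K.
  card-map-S-Y : ∀ {d m r ρ} (φ : V d → V m) → IsHom φ → (Y : Subgroup d) → HasRank (Img φ Y) ρ →
    (e : Fin r → V d) → (∀ j → Y ∋ e j) →
    Σ ℕ λ C → ∀ K → 1 ℕ.≤ K → card (map φ (S-Y e K)) ℕ.≤ C ℕ.* K ^ ρ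
  card-map-S-Y {d} {m} {r} {ρ} φ hom Y ((h , h∈ , h-indep) , rank-max) e e∈Y = (suc B ℕ.+ B) ^ ρ , bound
    where
    open Homomorphism φ hom
    dual : DualBasis h
    dual = dualBasis ρ h h-indep
    open DualBasis dual
    coeff : Fin ρ → Fin r → ℤ
    coeff l j = dot (Λ l) (φ (e j))
    B : ℕ
    B = sumℕ (λ l → sumℕ (λ j → ℤ.∣ coeff l j ∣))
    Ψ : V m → V ρ
    Ψ w = Vec.tabulate (λ l → dot (Λ l) w)

    ∈-image⁻ : ∀ K {w} → w ∈ map φ (S-Y e K) → ∃ λ (a : Fin r → ℕ) → (∀ j → a j ℕ.< K) × w ≡ lincomb (λ j → + a j) (φ ∘ e)
    ∈-image⁻ K w∈ with ∈P.∈-map⁻ φ w∈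
    ... | s , s∈ , refl with ∈-S-Y⁻ e K s∈
    ...   | a , a<K , refl = a , a<K , hom-lincomb (λ j → + a j) e

    Ψ-bound : ∀ K {w} → w ∈ map φ (S-Y e K) → ∀ l → ℤ.∣ dot (Λ l) w ∣ ℕ.≤ K ℕ.* B
    Ψ-bound K w∈ l with ∈-image⁻ K w∈
    ... | a , a<K , refl = begin
      ℤ.∣ dot (Λ l) (lincomb (λ j → + a j) (φ ∘ e)) ∣  ≡⟨ cong ℤ.∣_∣ (dot-lincombʳ (Λ l) (λ j → + a j) (φ ∘ e)) ⟩
      ℤ.∣ sum (λ j → + a j * coeff l j) ∣             ≤⟨ ∣sum∣≤sumℕ∣∣ (λ j → + a j * coeff l j) ⟩
      sumℕ (λ j → ℤ.∣ + a j * coeff l j ∣)            ≤⟨ sumℕ-mono (λ j → ℕP.≤-trans (ℕP.≤-reflexive (ℤP.abs-* (+ a j) (coeff l j)))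
                                                                                  (ℕP.*-monoˡ-≤ ℤ.∣ coeff l j ∣ (ℕP.<⇒≤ (a<K j)))) ⟩
      sumℕ (λ j → K ℕ.* ℤ.∣ coeff l j ∣)              ≡⟨ sumℕ-* K (λ j → ℤ.∣ coeff l j ∣) ⟩
      K ℕ.* sumℕ (λ j → ℤ.∣ coeff l j ∣)              ≤⟨ ℕP.*-monoʳ-≤ K (term≤sumℕ (λ l → sumℕ (λ j → ℤ.∣ coeff l j ∣)) l) ⟩
      K ℕ.* B                                         ∎
      where open ℕP.≤-Reasoning

    φe∈span : DoubleNegation (∀ j → InRatSpan h (φ (e j)))
    φe∈span = ¬¬-∀Fin (λ j → HasRank⇒InRatSpan (Img φ Y) ((h , h∈ , h-indep) , rank-max) h h∈ h-indep (φ (e j)) (e j , e∈Y j , refl))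

    bound : ∀ K → 1 ℕ.≤ K → card (map φ (S-Y e K)) ℕ.≤ (suc B ℕ.+ B) ^ ρ ℕ.* K ^ ρ
    bound K 1≤K = decidable-stable (_ ℕP.≤? _) (¬¬-map count φe∈span)
      where
      image : List (V m)
      image = map φ (S-Y e K)
      distinct : List (V m)
      distinct = deduplicate _≟v_ image
      count : (∀ j → InRatSpan h (φ (e j))) → card image ℕ.≤ (suc B ℕ.+ B) ^ ρ ℕ.* K ^ ρ
      count φe∈ = begin
        card image                                 ≡⟨ sym (ListP.length-map Ψ distinct) ⟩
        length (map Ψ distinct)                    ≤⟨ Unique-⊆⇒length≤ (Unique-map Ψ Ψ-injective (DecUniqueP.deduplicate-! _≟v_ image)) Ψ-image⊆ ⟩
        length (grid {n = ρ} (λ _ → range (K ℕ.* B)))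
          ≡⟨ trans (length-grid {n = ρ} (λ _ → range (K ℕ.* B))) (trans (prodℕ-cong {ρ} (λ _ → length-range (K ℕ.* B))) (prodℕ-const ρ _)) ⟩
        (suc (K ℕ.* B) ℕ.+ K ℕ.* B) ^ ρ            ≤⟨ ℕP.^-monoˡ-≤ ρ side≤ ⟩
        ((suc B ℕ.+ B) ℕ.* K) ^ ρ                  ≡⟨ ^-distrib-* (suc B ℕ.+ B) K ρ ⟩
        (suc B ℕ.+ B) ^ ρ ℕ.* K ^ ρ                ∎
        where
        open ℕP.≤-Reasoning
        side≤ : suc (K ℕ.* B) ℕ.+ K ℕ.* B ℕ.≤ (suc B ℕ.+ B) ℕ.* K
        side≤ = ℕP.≤-trans (ℕP.+-monoˡ-≤ (K ℕ.* B) (ℕP.+-monoˡ-≤ (K ℕ.* B) 1≤K)) (ℕP.≤-reflexive (regroup K B))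
          where
          regroup : ∀ K B → K ℕ.+ K ℕ.* B ℕ.+ K ℕ.* B ≡ (suc B ℕ.+ B) ℕ.* K
          regroup = ℕSolver.solve-∀
        image∈span : ∀ {w} → w ∈ image → InRatSpan h w
        image∈span w∈ with ∈-image⁻ K w∈
        ... | a , _ , refl = InRatSpan-lincomb h (λ j → + a j) (φ ∘ e) φe∈
        Ψ-injective : ∀ {x y} → x ∈ distinct → y ∈ distinct → Ψ x ≡ Ψ y → x ≡ y
        Ψ-injective {x} {y} x∈ y∈ Ψx≡Ψy =
          dual-coordinates-injective dual (image∈span (∈P.∈-deduplicate⁻ _≟v_ image x∈)) (image∈span (∈P.∈-deduplicate⁻ _≟v_ image y∈))
            (λ l → trans (sym (VecP.lookup∘tabulate _ l)) (trans (cong (λ v → lookup v l) Ψx≡Ψy) (VecP.lookup∘tabulate _ l)))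
        Ψ-image⊆ : map Ψ distinct ⊆ grid {n = ρ} (λ _ → range (K ℕ.* B))
        Ψ-image⊆ v∈ with ∈P.∈-map⁻ Ψ v∈
        ... | x , x∈ , refl = ∈-grid⁺ (λ _ → range (K ℕ.* B)) (Ψ x)
          (λ l → subst (_∈ range (K ℕ.* B)) (sym (VecP.lookup∘tabulate _ l)) (∈-range (K ℕ.* B) _ (Ψ-bound K (∈P.∈-deduplicate⁻ _≟v_ image x∈) l)))

-- Integer parts of rational powers

module _ where
  open import Data.Nat using (_+_; _*_; _≤_; _<_)

  m≤m^n : ∀ m n → 1 ≤ n → m ≤ m ^ n
  m≤m^n zero n _ = z≤n
  m≤m^n (suc m) (suc n) _ = ℕP.≤-trans (ℕP.≤-reflexive (sym (ℕP.*-identityʳ (suc m))))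
                                       (ℕP.*-monoʳ-≤ (suc m) (ℕP.≤-trans (ℕP.≤-reflexive (sym (ℕP.^-zeroˡ n))) (ℕP.^-monoˡ-≤ n (s≤s z≤n))))

  ^-cancelʳ-≤ : ∀ a b n → 1 ≤ n → a ^ n ≤ b ^ n → a ≤ b
  ^-cancelʳ-≤ a b (suc n) _ aⁿ≤bⁿ with a ℕP.≤? b
  ... | yes a≤b = a≤b
  ... | no a≰b = ⊥-elim (ℕP.<⇒≱ (ℕP.^-monoˡ-< (suc n) (ℕP.≰⇒> a≰b)) aⁿ≤bⁿ)

  count-downClosed : ∀ {P : ℕ → Set} (P? : Decidable P) (f : ℕ → ℕ) n → (∀ j → P (f (suc j)) → P (f j)) →
    (∀ j → j < length (filter P? (applyUpTo f n)) → P (f j))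
    × (length (filter P? (applyUpTo f n)) < n → ¬ P (f (length (filter P? (applyUpTo f n)))))
  count-downClosed P? f zero _ = (λ j ()) , (λ ())
  count-downClosed P? f (suc n) closed with P? (f 0) | count-downClosed P? (f ∘ suc) n (closed ∘ suc)
  ... | yes Pf₀ | (below , above) = (λ { zero _ → Pf₀ ; (suc j) (s≤s j<c) → below j j<c }) , (λ { (s≤s c<n) → above c<n })
  ... | no ¬Pf₀ | (below , _) with length (filter P? (applyUpTo (f ∘ suc) n))
  ...   | zero = (λ j ()) , (λ _ → ¬Pf₀)
  ...   | suc _ = ⊥-elim (¬Pf₀ (closed 0 (below 0 (s≤s z≤n))))

  -- floorPow M q = K is characterised by K ^ s ≤ M ^ p < (K + 1) ^ s, where q = p / s.
  module FloorPow (M : ℕ) (q : ℚ) (1≤M : 1 ≤ M) where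
    private
      s p N K count : ℕ
      s = ↧ₙ q
      p = numℕ q
      N = M ^ p
      K = floorPow M q
      count = length (filter (λ k → k ^ s ℕP.≤? N) (applyUpTo suc N))
      K≡count : K ≡ count
      K≡count = cong (λ l → length (filter (λ k → k ^ s ℕP.≤? N) l)) (ListP.map-upTo suc N)
      1≤s : 1 ≤ s
      1≤s = ℕP.n≢0⇒n>0 (λ ())
      1≤N : 1 ≤ N
      1≤N = ℕP.≤-trans (ℕP.≤-reflexive (sym (ℕP.^-zeroˡ p))) (ℕP.^-monoˡ-≤ p 1≤M)
      boundary : (∀ j → j < count → suc j ^ s ≤ N) × (count < N → ¬ suc count ^ s ≤ N)
      boundary = count-downClosed (λ k → k ^ s ℕP.≤? N) suc N (λ j → ℕP.≤-trans (ℕP.^-monoˡ-≤ s (ℕP.n≤1+n (suc j))))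
      1≤count : 1 ≤ count
      1≤count with count in count≡
      ... | zero = ⊥-elim (proj₂ boundary (subst (_< N) (sym count≡) 1≤N)
                                          (subst (λ c → suc c ^ s ≤ N) (sym count≡) (ℕP.≤-trans (ℕP.≤-reflexive (ℕP.^-zeroˡ s)) 1≤N)))
      ... | suc _ = s≤s z≤n
      count^s≤N : count ^ s ≤ N
      count^s≤N with count in count≡
      ... | zero = ⊥-elim (ℕP.<⇒≱ 1≤count (ℕP.≤-reflexive count≡))
      ... | suc k = proj₁ boundary k (subst (k <_) (sym count≡) ℕP.≤-refl)
      N<[1+count]^s : N < suc count ^ s
      N<[1+count]^s with count ℕP.<? N
      ... | yes count<N = ℕP.≰⇒> (proj₂ boundary count<N)
      ... | no count≮N = ℕP.<-≤-trans (ℕP.≤-<-trans (ℕP.≮⇒≥ count≮N) (ℕP.n<1+n count)) (m≤m^n (suc count) s 1≤s)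

    floorPow≥1 : 1 ≤ K
    floorPow≥1 = subst (1 ≤_) (sym K≡count) 1≤count

    floorPow^den≤ : K ^ s ≤ M ^ p
    floorPow^den≤ = subst (λ c → c ^ s ≤ N) (sym K≡count) count^s≤N

    ≤2^den*floorPow^den : M ^ p ≤ 2 ^ s * K ^ s
    ≤2^den*floorPow^den = begin
      N            ≤⟨ ℕP.<⇒≤ (subst (λ c → N < suc c ^ s) (sym K≡count) N<[1+count]^s) ⟩
      suc K ^ s    ≤⟨ ℕP.^-monoˡ-≤ s (ℕP.+-monoˡ-≤ K floorPow≥1) ⟩
      (K + K) ^ s  ≡⟨ cong (λ x → (K + x) ^ s) (sym (ℕP.+-identityʳ K)) ⟩
      (2 * K) ^ s  ≡⟨ ^-distrib-* 2 K s ⟩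
      2 ^ s * K ^ s ∎
      where open ℕP.≤-Reasoning

  -- the numerator of Σᵢ ρᵢ pᵢ / sᵢ over the common denominator Πᵢ sᵢ
  fracSumNum : ∀ {t} (p s ρ : Fin t → ℕ) → ℕ
  fracSumNum {zero} p s ρ = 0
  fracSumNum {suc t} p s ρ = p zero * ρ zero * prodℕ (s ∘ suc) + s zero * fracSumNum (p ∘ suc) (s ∘ suc) (ρ ∘ suc)

  prodPowConst : ∀ {t} (c s ρ : Fin t → ℕ) → ℕ
  prodPowConst {zero} c s ρ = 1
  prodPowConst {suc t} c s ρ = c zero ^ (ρ zero * prodℕ (s ∘ suc)) * prodPowConst (c ∘ suc) (s ∘ suc) (ρ ∘ suc) ^ s zero

  private
    split-base : ∀ K ρ s S Z → (K ^ ρ * Z) ^ (s * S) ≡ (K ^ s) ^ (ρ * S) * (Z ^ S) ^ s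
    split-base K ρ s S Z = begin
      (K ^ ρ * Z) ^ (s * S)             ≡⟨ ^-distrib-* (K ^ ρ) Z (s * S) ⟩
      (K ^ ρ) ^ (s * S) * Z ^ (s * S)   ≡⟨ cong₂ _*_ (trans (ℕP.^-*-assoc K ρ (s * S)) (trans (cong (K ^_) (swap ρ s S)) (sym (ℕP.^-*-assoc K s (ρ * S)))))
                                                    (trans (cong (Z ^_) (ℕP.*-comm s S)) (sym (ℕP.^-*-assoc Z S s))) ⟩
      (K ^ s) ^ (ρ * S) * (Z ^ S) ^ s   ∎
      where
      open ≡-Reasoning
      swap : ∀ a b c → a * (b * c) ≡ b * (a * c)
      swap = ℕSolver.solve-∀

    split-exponent : ∀ M p ρ S N s → M ^ (p * ρ * S + s * N) ≡ (M ^ p) ^ (ρ * S) * (M ^ N) ^ s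
    split-exponent M p ρ S N s = begin
      M ^ (p * ρ * S + s * N)                ≡⟨ cong (M ^_) (regroup p ρ S N s) ⟩
      M ^ (p * (ρ * S) + N * s)              ≡⟨ ℕP.^-distribˡ-+-* M (p * (ρ * S)) (N * s) ⟩
      M ^ (p * (ρ * S)) * M ^ (N * s)        ≡⟨ sym (cong₂ _*_ (ℕP.^-*-assoc M p (ρ * S)) (ℕP.^-*-assoc M N s)) ⟩
      (M ^ p) ^ (ρ * S) * (M ^ N) ^ s        ∎
      where
      open ≡-Reasoning
      regroup : ∀ p ρ S N s → p * ρ * S + s * N ≡ p * (ρ * S) + N * s
      regroup = ℕSolver.solve-∀

  -- If Kᵢ ^ sᵢ is comparable to M ^ pᵢ then Πᵢ Kᵢ ^ ρᵢ is comparable to M ^ (Σᵢ ρᵢ pᵢ / sᵢ), after raising to Πᵢ sᵢ.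
  prodPow-≤ : ∀ {t} M (K p s ρ : Fin t → ℕ) → (∀ i → K i ^ s i ≤ M ^ p i) →
    prodℕ (λ i → K i ^ ρ i) ^ prodℕ s ≤ M ^ fracSumNum p s ρ
  prodPow-≤ {zero} M K p s ρ _ = ℕP.≤-refl
  prodPow-≤ {suc t} M K p s ρ K^s≤M^p = begin
    (K zero ^ ρ zero * Z) ^ (s zero * S')                 ≡⟨ split-base (K zero) (ρ zero) (s zero) S' Z ⟩
    (K zero ^ s zero) ^ (ρ zero * S') * (Z ^ S') ^ s zero ≤⟨ ℕP.*-mono-≤ (ℕP.^-monoˡ-≤ (ρ zero * S') (K^s≤M^p zero))
                                                                        (ℕP.^-monoˡ-≤ (s zero) (prodPow-≤ M (K ∘ suc) (p ∘ suc) (s ∘ suc) (ρ ∘ suc) (K^s≤M^p ∘ suc))) ⟩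
    (M ^ p zero) ^ (ρ zero * S') * (M ^ N') ^ s zero      ≡⟨ sym (split-exponent M (p zero) (ρ zero) S' N' (s zero)) ⟩
    M ^ fracSumNum p s ρ                                  ∎
    where
    open ℕP.≤-Reasoning
    Z : ℕ
    Z = prodℕ (λ i → K (suc i) ^ ρ (suc i))
    S' N' : ℕ
    S' = prodℕ (s ∘ suc)
    N' = fracSumNum (p ∘ suc) (s ∘ suc) (ρ ∘ suc)

  prodPow-≥ : ∀ {t} M (K p s ρ c : Fin t → ℕ) → (∀ i → M ^ p i ≤ c i * K i ^ s i) →
    M ^ fracSumNum p s ρ ≤ prodPowConst c s ρ * prodℕ (λ i → K i ^ ρ i) ^ prodℕ s
  prodPow-≥ {zero} M K p s ρ c _ = ℕP.≤-refl
  prodPow-≥ {suc t} M K p s ρ c M^p≤cK^s = begin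
    M ^ fracSumNum p s ρ
      ≡⟨ split-exponent M (p zero) (ρ zero) S' N' (s zero) ⟩
    (M ^ p zero) ^ (ρ zero * S') * (M ^ N') ^ s zero
      ≤⟨ ℕP.*-mono-≤ (ℕP.^-monoˡ-≤ (ρ zero * S') (M^p≤cK^s zero))
                     (ℕP.^-monoˡ-≤ (s zero) (prodPow-≥ M (K ∘ suc) (p ∘ suc) (s ∘ suc) (ρ ∘ suc) (c ∘ suc) (M^p≤cK^s ∘ suc))) ⟩
    (c zero * K zero ^ s zero) ^ (ρ zero * S') * (C' * Z ^ S') ^ s zero
      ≡⟨ cong₂ _*_ (^-distrib-* (c zero) (K zero ^ s zero) (ρ zero * S')) (^-distrib-* C' (Z ^ S') (s zero)) ⟩
    c zero ^ (ρ zero * S') * (K zero ^ s zero) ^ (ρ zero * S') * (C' ^ s zero * (Z ^ S') ^ s zero)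
      ≡⟨ interchange (c zero ^ (ρ zero * S')) ((K zero ^ s zero) ^ (ρ zero * S')) (C' ^ s zero) ((Z ^ S') ^ s zero) ⟩
    prodPowConst c s ρ * ((K zero ^ s zero) ^ (ρ zero * S') * (Z ^ S') ^ s zero)
      ≡⟨ cong (prodPowConst c s ρ *_) (sym (split-base (K zero) (ρ zero) (s zero) S' Z)) ⟩
    prodPowConst c s ρ * (K zero ^ ρ zero * Z) ^ (s zero * S') ∎
    where
    open ℕP.≤-Reasoning
    Z : ℕ
    Z = prodℕ (λ i → K (suc i) ^ ρ (suc i))
    S' N' : ℕ
    S' = prodℕ (s ∘ suc)
    N' = fracSumNum (p ∘ suc) (s ∘ suc) (ρ ∘ suc)
    C' : ℕ
    C' = prodPowConst (c ∘ suc) (s ∘ suc) (ρ ∘ suc)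
    interchange : ∀ a b c d → a * b * (c * d) ≡ (a * c) * (b * d)
    interchange = ℕSolver.solve-∀

  rescale-exponent : ∀ {X M N S P s} C → 1 ≤ S → P * S ≡ N * s → X ^ S ≤ M ^ N → M ^ N ≤ C * X ^ S →
    (M ^ P ≤ C ^ s * X ^ s) × (X ^ s ≤ M ^ P)
  rescale-exponent {X} {M} {N} {S} {P} {s} C 1≤S PS≡Ns X^S≤M^N M^N≤CX^S =
    ^-cancelʳ-≤ (M ^ P) (C ^ s * X ^ s) S 1≤S lower , ^-cancelʳ-≤ (X ^ s) (M ^ P) S 1≤S upper
    where
    open ℕP.≤-Reasoning
    swap-exponents : ∀ Y → (Y ^ s) ^ S ≡ (Y ^ S) ^ s
    swap-exponents Y = trans (ℕP.^-*-assoc Y s S) (trans (cong (Y ^_) (ℕP.*-comm s S)) (sym (ℕP.^-*-assoc Y S s)))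
    M^P^S≡M^N^s : (M ^ P) ^ S ≡ (M ^ N) ^ s
    M^P^S≡M^N^s = trans (ℕP.^-*-assoc M P S) (trans (cong (M ^_) PS≡Ns) (sym (ℕP.^-*-assoc M N s)))
    upper : (X ^ s) ^ S ≤ (M ^ P) ^ S
    upper = begin
      (X ^ s) ^ S  ≡⟨ swap-exponents X ⟩
      (X ^ S) ^ s  ≤⟨ ℕP.^-monoˡ-≤ s X^S≤M^N ⟩
      (M ^ N) ^ s  ≡⟨ sym M^P^S≡M^N^s ⟩
      (M ^ P) ^ S  ∎
    lower : (M ^ P) ^ S ≤ (C ^ s * X ^ s) ^ S
    lower = begin
      (M ^ P) ^ S                 ≡⟨ M^P^S≡M^N^s ⟩
      (M ^ N) ^ s                 ≤⟨ ℕP.^-monoˡ-≤ s M^N≤CX^S ⟩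
      (C * X ^ S) ^ s             ≡⟨ ^-distrib-* C (X ^ S) s ⟩
      C ^ s * (X ^ S) ^ s         ≡⟨ cong (C ^ s *_) (sym (swap-exponents X)) ⟩
      C ^ s * (X ^ s) ^ S         ≤⟨ ℕP.*-monoˡ-≤ ((X ^ s) ^ S) (m≤m^n (C ^ s) S 1≤S) ⟩
      (C ^ s) ^ S * (X ^ s) ^ S   ≡⟨ sym (^-distrib-* (C ^ s) (X ^ s) S) ⟩
      (C ^ s * X ^ s) ^ S         ∎

-- The value of the dual vector as a fraction

module _ where
  open import Data.Integer using (_+_; _*_)
  open ℤSolver using (solve-∀)

  ℕ→ℚ : ℕ → ℚ
  ℕ→ℚ k = (+ k) ℚ./ 1

  ∑ℚ : ∀ {t} → (Fin t → ℚ) → ℚ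
  ∑ℚ {zero} f = 0ℚ
  ∑ℚ {suc t} f = f zero ℚ.+ ∑ℚ (f ∘ suc)

  foldr-+-tabulate : ∀ {a} {A : Set a} {t} (g : Fin t → A) (F : A → ℚ) →
    List.foldr ℚ._+_ 0ℚ (map F (List.tabulate g)) ≡ ∑ℚ (λ i → F (g i))
  foldr-+-tabulate {t = zero} g F = refl
  foldr-+-tabulate {t = suc t} g F = cong (F (g zero) ℚ.+_) (foldr-+-tabulate (g ∘ suc) F)

  record IsFrac (u : ℚᵘ) (N S : ℕ) : Set where
    constructor isFrac
    field
      cross : ℚᵘ.↥ u * + S ≡ + N * ℚᵘ.↧ u

  IsFrac-≃ : ∀ {u v N S} → u ≃ v → IsFrac u N S → IsFrac v N S
  IsFrac-≃ {mkℚᵘ a b} {mkℚᵘ c d} {N} {S} (*≡* ad≡cb) (isFrac aS≡Nb) = isFrac (ℤP.*-cancelʳ-≡ (c * + S) (+ N * +[1+ d ]) +[1+ b ] (begin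
    c * + S * +[1+ b ]         ≡⟨ swap c (+ S) +[1+ b ] ⟩
    c * +[1+ b ] * + S         ≡⟨ cong (_* + S) (sym ad≡cb) ⟩
    a * +[1+ d ] * + S         ≡⟨ swap a +[1+ d ] (+ S) ⟩
    a * + S * +[1+ d ]         ≡⟨ cong (_* +[1+ d ]) aS≡Nb ⟩
    + N * +[1+ b ] * +[1+ d ]  ≡⟨ swap (+ N) +[1+ b ] +[1+ d ] ⟩
    + N * +[1+ d ] * +[1+ b ]  ∎))
    where
    open ≡-Reasoning
    swap : ∀ x y z → x * y * z ≡ x * z * y
    swap = solve-∀

  IsFrac-+ : ∀ {u v N S N' S'} → IsFrac u N S → IsFrac v N' S' → IsFrac (u ℚᵘ.+ v) (N ℕ.* S' ℕ.+ S ℕ.* N') (S ℕ.* S')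
  IsFrac-+ {mkℚᵘ a b} {mkℚᵘ c d} {N} {S} {N'} {S'} (isFrac aS≡Nb) (isFrac cS'≡N'd) = isFrac (begin
    (a * +[1+ d ] + c * +[1+ b ]) * + (S ℕ.* S')
      ≡⟨ cong ((a * +[1+ d ] + c * +[1+ b ]) *_) (ℤP.pos-* S S') ⟩
    (a * +[1+ d ] + c * +[1+ b ]) * (+ S * + S')
      ≡⟨ expand a (+ S) c (+ S') +[1+ b ] +[1+ d ] ⟩
    (a * + S) * +[1+ d ] * + S' + (c * + S') * +[1+ b ] * + S
      ≡⟨ cong₂ (λ x y → x * +[1+ d ] * + S' + y * +[1+ b ] * + S) aS≡Nb cS'≡N'd ⟩
    + N * +[1+ b ] * +[1+ d ] * + S' + + N' * +[1+ d ] * +[1+ b ] * + S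
      ≡⟨ collect (+ N) (+ S') (+ S) (+ N') +[1+ b ] +[1+ d ] ⟩
    (+ N * + S' + + S * + N') * (+[1+ b ] * +[1+ d ])
      ≡⟨ cong₂ _*_ (sym (trans (ℤP.pos-+ (N ℕ.* S') (S ℕ.* N')) (cong₂ _+_ (ℤP.pos-* N S') (ℤP.pos-* S N')))) (sym (ℤP.pos-* (suc b) (suc d))) ⟩
    + (N ℕ.* S' ℕ.+ S ℕ.* N') * + (suc b ℕ.* suc d) ∎)
    where
    open ≡-Reasoning
    expand : ∀ a S c S' B D → (a * D + c * B) * (S * S') ≡ (a * S) * D * S' + (c * S') * B * S
    expand = solve-∀
    collect : ∀ N S' S N' B D → N * B * D * S' + N' * D * B * S ≡ (N * S' + S * N') * (B * D)
    collect = solve-∀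

  IsFrac-* : ∀ {u v N S N' S'} → IsFrac u N S → IsFrac v N' S' → IsFrac (u ℚᵘ.* v) (N ℕ.* N') (S ℕ.* S')
  IsFrac-* {mkℚᵘ a b} {mkℚᵘ c d} {N} {S} {N'} {S'} (isFrac aS≡Nb) (isFrac cS'≡N'd) = isFrac (begin
    (a * c) * + (S ℕ.* S')               ≡⟨ cong ((a * c) *_) (ℤP.pos-* S S') ⟩
    (a * c) * (+ S * + S')               ≡⟨ interchange a c (+ S) (+ S') ⟩
    (a * + S) * (c * + S')               ≡⟨ cong₂ _*_ aS≡Nb cS'≡N'd ⟩
    (+ N * +[1+ b ]) * (+ N' * +[1+ d ]) ≡⟨ interchange (+ N) +[1+ b ] (+ N') +[1+ d ] ⟩
    (+ N * + N') * (+[1+ b ] * +[1+ d ]) ≡⟨ cong₂ _*_ (sym (ℤP.pos-* N N')) (sym (ℤP.pos-* (suc b) (suc d))) ⟩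
    + (N ℕ.* N') * + (suc b ℕ.* suc d)   ∎)
    where
    open ≡-Reasoning
    interchange : ∀ a c S S' → (a * c) * (S * S') ≡ (a * S) * (c * S')
    interchange = solve-∀

  IsFrac-pos : ∀ y → 0ℚ ℚ.< y → IsFrac (toℚᵘ y) (numℕ y) (↧ₙ y)
  IsFrac-pos (mkℚ (+ n) d c) _ = isFrac refl
  IsFrac-pos (mkℚ -[1+ n ] d c) (ℚ.*<* ())

  IsFrac-ℕ→ℚ : ∀ k → IsFrac (toℚᵘ (ℕ→ℚ k)) k 1
  IsFrac-ℕ→ℚ k = lemma (ℕ→ℚ k) (begin
      ↥ ℕ→ℚ k * + 1          ≡⟨ cong (↥ ℕ→ℚ k *_) (sym (ℚP.↧-/ (+ k) 1)) ⟩
      ↥ ℕ→ℚ k * (↧ ℕ→ℚ k * g) ≡⟨ swap (↥ ℕ→ℚ k) (↧ ℕ→ℚ k) g ⟩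
      (↥ ℕ→ℚ k * g) * ↧ ℕ→ℚ k ≡⟨ cong (_* ↧ ℕ→ℚ k) (ℚP.↥-/ (+ k) 1) ⟩
      + k * ↧ ℕ→ℚ k            ∎)
    where
    open ≡-Reasoning
    g : ℤ
    g = Data.Integer.GCD.gcd (+ k) (+ 1)
    swap : ∀ a b c → a * (b * c) ≡ (a * c) * b
    swap = solve-∀
    lemma : ∀ q → ↥ q * + 1 ≡ + k * ↧ q → IsFrac (toℚᵘ q) k 1
    lemma (mkℚ _ _ _) eq = isFrac eq

  IsFrac-∑ : ∀ {t} (y : Fin t → ℚ) → (∀ i → 0ℚ ℚ.< y i) → (ρ : Fin t → ℕ) →
    IsFrac (toℚᵘ (∑ℚ (λ i → y i ℚ.* ℕ→ℚ (ρ i)))) (fracSumNum (λ i → numℕ (y i)) (λ i → ↧ₙ (y i)) ρ) (prodℕ (λ i → ↧ₙ (y i)))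
  IsFrac-∑ {zero} y y>0 ρ = isFrac refl
  IsFrac-∑ {suc t} y y>0 ρ =
    subst₂ (IsFrac (toℚᵘ (head ℚ.+ tail))) (cong (λ z → numℕ (y zero) ℕ.* ρ zero ℕ.* S' ℕ.+ z ℕ.* N') (ℕP.*-identityʳ (↧ₙ (y zero))))
                                            (cong (ℕ._* S') (ℕP.*-identityʳ (↧ₙ (y zero))))
      (IsFrac-≃ (ℚᵘP.≃-sym (ℚP.toℚᵘ-homo-+ head tail))
        (IsFrac-+ (IsFrac-≃ (ℚᵘP.≃-sym (ℚP.toℚᵘ-homo-* (y zero) (ℕ→ℚ (ρ zero))))
                            (IsFrac-* (IsFrac-pos (y zero) (y>0 zero)) (IsFrac-ℕ→ℚ (ρ zero))))
                  (IsFrac-∑ (y ∘ suc) (y>0 ∘ suc) (ρ ∘ suc))))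
    where
    head tail : ℚ
    head = y zero ℚ.* ℕ→ℚ (ρ zero)
    tail = ∑ℚ (λ i → y (suc i) ℚ.* ℕ→ℚ (ρ (suc i)))
    S' N' : ℕ
    S' = prodℕ (λ i → ↧ₙ (y (suc i)))
    N' = fracSumNum (λ i → numℕ (y (suc i))) (λ i → ↧ₙ (y (suc i))) (ρ ∘ suc)

  private
    -[1+n]*S≢N*d : ∀ n S N d → -[1+ n ] * + suc S ≢ + N * +[1+ d ]
    -[1+n]*S≢N*d n S N d eq with trans eq (sym (ℤP.pos-* N (suc d)))
    ... | ()

  IsFrac⇒num*S≡N*den : ∀ (q : ℚ) N S → 1 ℕ.≤ S → IsFrac (toℚᵘ q) N S → numℕ q ℕ.* S ≡ N ℕ.* ↧ₙ q
  IsFrac⇒num*S≡N*den (mkℚ (+ n) d _) N S _ (isFrac eq) = ℤP.+-injective (trans (ℤP.pos-* n S) (trans eq (sym (ℤP.pos-* N (suc d)))))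
  IsFrac⇒num*S≡N*den (mkℚ -[1+ n ] d _) N (suc S) _ (isFrac eq) = ⊥-elim (-[1+n]*S≢N*d n S N d eq)

  IsFrac-≤1 : ∀ (q : ℚ) N S → 1 ℕ.≤ S → IsFrac (toℚᵘ q) N S → q ℚ.≤ 1ℚ → N ℕ.≤ S
  IsFrac-≤1 q@(mkℚ (+ n) d _) N S 1≤S eq (ℚ.*≤* n*1≤1*d) =
    ℕP.*-cancelʳ-≤ N S (suc d) (ℕP.≤-trans (ℕP.≤-reflexive (sym (IsFrac⇒num*S≡N*den q N S 1≤S eq)))
                                           (ℕP.≤-trans (ℕP.*-monoˡ-≤ S n≤d) (ℕP.≤-reflexive (ℕP.*-comm (suc d) S))))
    where
    n≤d : n ℕ.≤ suc d
    n≤d = ℤP.drop‿+≤+ (subst₂ ℤ._≤_ (ℤP.*-identityʳ (+ n)) (ℤP.*-identityˡ (+ suc d)) n*1≤1*d)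
  IsFrac-≤1 (mkℚ -[1+ n ] d _) N (suc S) _ (isFrac eq) _ = ⊥-elim (-[1+n]*S≢N*d n S N d eq)

-- Product parallelepipeds

module _ where
  open import Data.Nat using (_*_; _≤_)

  card-parallelepiped : ∀ {d t} (r : Fin t → ℕ) (e : (i : Fin t) → Fin (r i) → V d) (K : Fin t → ℕ) →
    LinIndep (flatten r e) → card (parallelepiped r e K) ≡ prodℕ (λ i → K i ^ r i)
  card-parallelepiped r e K indep =
    ℕP.≤-antisym (ℕP.≤-trans (card≤length (parallelepiped r e K)) (ℕP.≤-reflexive (Parallelepiped.length-parallelepiped r e K)))
                 (card-parallelepiped-≥ r e K indep)

  productParallelepiped-tiles : ∀ {d t} (r : Fin t → ℕ) (e : (i : Fin t) → Fin (r i) → V d) (yv : Fin t → ℚ) →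
    LinIndep (flatten r e) → (M : ℕ) → 1 ≤ M → Tiles (productParallelepiped r e yv M)
  productParallelepiped-tiles r e yv indep M 1≤M =
    parallelepiped-tiles r e (λ i → floorPow M (yv i)) (λ i → ℕ.≢-nonZero⁻¹ _ {{ℕ.>-nonZero (FloorPow.floorPow≥1 M (yv i) 1≤M)}}) indep

  card-productParallelepiped-Θ : ∀ {d t} (r : Fin t → ℕ) (e : (i : Fin t) → Fin (r i) → V d) (yv : Fin t → ℚ) →
    (∀ i → 0ℚ ℚ.< yv i) → LinIndep (flatten r e) →
    IsΘPow (λ M → card (productParallelepiped r e yv M)) (∑ℚ (λ i → yv i ℚ.* ℕ→ℚ (r i)))
  card-productParallelepiped-Θ {t = t} r e yv yv>0 indep = C ^ ↧ₙ val , 1 , 1 , bounds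
    where
    val : ℚ
    val = ∑ℚ (λ i → yv i ℚ.* ℕ→ℚ (r i))
    p s : Fin t → ℕ
    p i = numℕ (yv i)
    s i = ↧ₙ (yv i)
    C : ℕ
    C = prodPowConst (λ i → 2 ^ s i) s r
    1≤∏s : 1 ≤ prodℕ s
    1≤∏s = prodℕ-pos s (λ _ → s≤s z≤n)
    bounds : ∀ M → 1 ≤ M → (M ^ numℕ val ≤ C ^ ↧ₙ val * card (productParallelepiped r e yv M) ^ ↧ₙ val)
                         × (card (productParallelepiped r e yv M) ^ ↧ₙ val ≤ 1 * M ^ numℕ val)
    bounds M 1≤M =
      subst (λ c → (M ^ numℕ val ≤ C ^ ↧ₙ val * c ^ ↧ₙ val) × (c ^ ↧ₙ val ≤ 1 * M ^ numℕ val))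
            (sym (card-parallelepiped r e K indep))
            (proj₁ rescaled , subst (X ^ ↧ₙ val ≤_) (sym (ℕP.*-identityˡ (M ^ numℕ val))) (proj₂ rescaled))
      where
      K : Fin t → ℕ
      K = λ i → floorPow M (yv i)
      X : ℕ
      X = prodℕ (λ i → K i ^ r i)
      rescaled : (M ^ numℕ val ≤ C ^ ↧ₙ val * X ^ ↧ₙ val) × (X ^ ↧ₙ val ≤ M ^ numℕ val)
      rescaled = rescale-exponent {X} {M} {fracSumNum p s r} {prodℕ s} {numℕ val} {↧ₙ val} C 1≤∏s (IsFrac⇒num*S≡N*den val _ _ 1≤∏s (IsFrac-∑ yv yv>0 r))
                   (prodPow-≤ M K p s r (λ i → FloorPow.floorPow^den≤ M (yv i) 1≤M))
                   (prodPow-≥ M K p s r (λ i → 2 ^ s i) (λ i → FloorPow.≤2^den*floorPow^den M (yv i) 1≤M))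

  card-map-productParallelepiped-O : ∀ {d m t} (φ : V d → V m) → IsHom φ → (Y : Fin t → Subgroup d)
    (r : Fin t → ℕ) (e : (i : Fin t) → Fin (r i) → V d) → (∀ i j → Y i ∋ e i j) →
    (yv : Fin t → ℚ) → (∀ i → 0ℚ ℚ.< yv i) → (ρ : Fin t → ℕ) → (∀ i → HasRank (Img φ (Y i)) (ρ i)) →
    ∑ℚ (λ i → yv i ℚ.* ℕ→ℚ (ρ i)) ℚ.≤ 1ℚ → IsBigOM (λ M → card (map φ (productParallelepiped r e yv M)))
  card-map-productParallelepiped-O {t = t} φ hom Y r e e∈Y yv yv>0 ρ rank-φY feasible = prodℕ C , 1 , bound
    where
    open Homomorphism φ hom
    p s : Fin t → ℕ
    p i = numℕ (yv i)
    s i = ↧ₙ (yv i)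
    1≤∏s : 1 ≤ prodℕ s
    1≤∏s = prodℕ-pos s (λ _ → s≤s z≤n)
    factor-bound : ∀ i → Σ ℕ λ C → ∀ K → 1 ≤ K → card (map φ (S-Y (e i) K)) ≤ C * K ^ ρ i
    factor-bound i = card-map-S-Y φ hom (Y i) (rank-φY i) (e i) (e∈Y i)
    C : Fin t → ℕ
    C i = proj₁ (factor-bound i)
    num≤∏s : fracSumNum p s ρ ≤ prodℕ s
    num≤∏s = IsFrac-≤1 _ (fracSumNum p s ρ) (prodℕ s) 1≤∏s (IsFrac-∑ yv yv>0 ρ) feasible
    bound : ∀ M → 1 ≤ M → card (map φ (productParallelepiped r e yv M)) ≤ prodℕ C * M
    bound M 1≤M = begin
      card (map φ (productParallelepiped r e yv M))   ≤⟨ card-map-⊕-all (λ i → S-Y (e i) (K i)) ⟩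
      prodℕ (λ i → card (map φ (S-Y (e i) (K i))))     ≤⟨ prodℕ-mono (λ i → proj₂ (factor-bound i) (K i) (FloorPow.floorPow≥1 M (yv i) 1≤M)) ⟩
      prodℕ (λ i → C i * K i ^ ρ i)                   ≡⟨ prodℕ-* C (λ i → K i ^ ρ i) ⟩
      prodℕ C * Z                                     ≤⟨ ℕP.*-monoʳ-≤ (prodℕ C) Z≤M ⟩
      prodℕ C * M                                     ∎
      where
      open ℕP.≤-Reasoning
      K : Fin t → ℕ
      K = λ i → floorPow M (yv i)
      Z : ℕ
      Z = prodℕ (λ i → K i ^ ρ i)
      Z≤M : Z ≤ M
      Z≤M = ^-cancelʳ-≤ Z M (prodℕ s) 1≤∏s
              (ℕP.≤-trans (prodPow-≤ M K p s ρ (λ i → FloorPow.floorPow^den≤ M (yv i) 1≤M))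
                          (ℕP.^-monoʳ-≤ M {{ℕ.>-nonZero 1≤M}} num≤∏s))

open import Data.Rational using (_<_)

mainTheorem8 : (d n : ℕ) (ds : Fin n → ℕ) (φ : (i : Fin n) → V d → V (ds i))
    → ((i : Fin n) → IsHom (φ i))
    → (t : ℕ) (Y : Fin t → Subgroup d) (yv : Fin t → ℚ)
    → (yv>0 : (i : Fin t) → 0ℚ < yv i)
    → (r : Fin t → ℕ) (rOK : (i : Fin t) → HasRank (Y i ∋_) (r i))
    → (rφ : Fin t → Fin n → ℕ)
    → (rφOK : (i : Fin t) (k : Fin n) → HasRank (Img (φ k) (Y i)) (rφ i k))
    → DualLP.Optimal ds φ (dualVector ds φ Y yv yv>0 r rOK rφ rφOK)
    → HasRank (SumOf Y) (sumℕ r)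
    → (e : (i : Fin t) → Fin (r i) → V d)
    → ((i : Fin t) (j : Fin (r i)) → Y i ∋ e i j)
    → ((i : Fin t) → LinIndep (e i))
    → AsymptoticallyOptimalTilings ds φ
    (DualLP.val ds φ (dualVector ds φ Y yv yv>0 r rOK rφ rφOK))
    (productParallelepiped r e yv)
mainTheorem8 d n ds φ hom t Y yv yv>0 r rOK rφ rφOK (feasible , _) rank-sum e e∈Y e-indep =
    productParallelepiped-tiles r e yv indep
  , subst (IsΘPow (λ M → card (productParallelepiped r e yv M))) (sym val≡) (card-productParallelepiped-Θ r e yv yv>0 indep)
  , λ k → card-map-productParallelepiped-O (φ k) (hom k) Y r e e∈Y yv yv>0 (λ i → rφ i k) (λ i → rφOK i k) (feasible′ k)
  where
  open DualLP ds φ using (Entry)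
  y : List Entry
  y = dualVector ds φ Y yv yv>0 r rOK rφ rφOK
  indep : LinIndep (flatten r e)
  indep = flatten-LinIndep Y r rOK rank-sum e e∈Y e-indep
  val≡ : DualLP.val ds φ y ≡ ∑ℚ (λ i → yv i ℚ.* ℕ→ℚ (r i))
  val≡ = foldr-+-tabulate {t = t} _ (λ x → Entry.coef x ℚ.* ℕ→ℚ (Entry.rk x))
  feasible′ : ∀ k → ∑ℚ (λ i → yv i ℚ.* ℕ→ℚ (rφ i k)) ℚ.≤ 1ℚ
  feasible′ k = subst (ℚ._≤ 1ℚ) (foldr-+-tabulate {t = t} _ (λ x → Entry.coef x ℚ.* ℕ→ℚ (Entry.rkφ x k))) (feasible k)
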